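{- Let $v$ be a 2-additive bi-capacity on $N$ with M\"obius transform $m$ and interaction transform $I$. Then for all distinct $i,j\in N$: $m(\{i,j\},N\setminus\{i,j\})=I_{\{i,j\},\emptyset}$, $m(\emptyset,N\setminus\{i,j\})=I_{\emptyset,\{i,j\}}$, $m(\{i\},N\setminus\{i,j\})=I_{\{i\},\{j\}}$, and for all $i\in N$: \[ m(\{i\},N\setminus\{i\})=I_{\{i\},\emptyset}-\tfrac12\sum_{j\neq i}\big[I_{\{i\},\{j\}}+I_{\{i,j\},\emptyset}\big],\qquad m(\emptyset,N\setminus\{i\})=I_{\emptyset,\{i\}}-\tfrac12\sum_{j\neq i}\big[I_{\{j\},\{i\}}+I_{\emptyset,\{i,j\}}\big]. \]
   Context: $N=\{1,\ldots,n\}$. $\mathcal{Q}(N)=\{(A,B):A,B\subseteq N,A\cap B=\emptyset\}$ with $(A,B)\sqsubseteq(C,D)$ iff $A\subseteq C$, $B\supseteq D$; a bi-capacity is an isotone $v:\mathcal{Q}(N)\to\mathbb{R}$ with $v(\emptyset,\emptyset)=0$. M\"obius transform: $m(A,A')=\sum_{B\subseteq A}\sum_{A'\subseteq B'\subseteq N\setminus A}(-1)^{|A\setminus B|+|B'\setminus A'|}v(B,B')$ (so $v(A,A')=\sum_{(B,B')\sqsubseteq(A,A')}m(B,B')$). $v$ is 2-additive if $m(A,B)=0$ for all $(A,B)\in\mathcal{Q}(N)$ with $|B|<n-2$. Interaction transform: for $(S,T)\in\mathcal{Q}(N)$ with $s=|S|,t=|T|$, $I_{S,T}=\sum_{K\subseteq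 N\setminus(S\cup T)}\frac{(n-s-t-k)!\,k!}{(n-s-t+1)!}\Delta_{S,T}v(K,N\setminus(K\cup S))$, $k=|K|$, where $\Delta_{S,T}v(K,L)=\sum_{S'\subseteq S}\sum_{T'\subseteq T}(-1)^{(s-|S'|)+(t-|T'|)}v(K\cup S',L\setminus T')$.
   Formalization: The bi-capacity v takes values in ℚ instead of ℝ. -}

module Defs where

open import Data.Nat as ℕ using (ℕ; zero; suc; _∸_; _!)
open import Data.Nat.Properties using (_!≢0)
open import Data.Bool using (Bool; true; false)
open import Data.Fin using (Fin)
open import Data.Fin.Properties using (_≟_)
open import Data.Fin.Subset using (Subset; _⊆_; _∩_; _∪_; ∁; _─_; ∣_∣; ⁅_⁆)
  renaming (⊥ to ∅)
open import Data.Fin.Subset.Properties using (_⊆?_)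
open import Data.Vec using (_∷_; [])
open import Data.List using (List; []; _∷_; _++_; map; filter; foldr; allFin)
open import Data.Integer using (+_)
open import Data.Rational using (ℚ; 0ℚ; 1ℚ; _+_; _*_; -_; _/_; _≤_)
open import Relation.Binary.PropositionalEquality using (_≡_)
open import Relation.Nullary using (¬_)
open import Relation.Nullary.Decidable using (_×-dec_; ¬?)

SetFun₂ : ℕ → Set
SetFun₂ n = Subset n → Subset n → ℚ

allSubsets : ∀ n → List (Subset n)
allSubsets zero = [] ∷ []
allSubsets (suc n) = map (false ∷_) (allSubsets n) ++ map (true ∷_) (allSubsets n)

sumL : ∀ {a} {A : Set a} → List A → (A → ℚ) → ℚ
sumL xs f = foldr (λ x acc → f x + acc) 0ℚ xs

neg1^ : ℕ → ℚ
neg1^ zero = 1ℚ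
neg1^ (suc k) = - neg1^ k

Disjoint : ∀ {n} → Subset n → Subset n → Set
Disjoint A B = A ∩ B ≡ ∅

IsBiCapacity : ∀ {n} → SetFun₂ n → Set
IsBiCapacity {n} v =
  (v ∅ ∅ ≡ 0ℚ) ×'
  (∀ (A B C D : Subset n) → Disjoint A B → Disjoint C D →
     A ⊆ C → D ⊆ B → v A B ≤ v C D)
  where
  open import Data.Product using () renaming (_×_ to _×'_)

mobius : ∀ {n} → SetFun₂ n → SetFun₂ n
mobius {n} v A A' =
  sumL (filter (_⊆? A) (allSubsets n)) λ B →
  sumL (filter (λ B' → (A' ⊆? B') ×-dec (B' ⊆? ∁ A)) (allSubsets n)) λ B' →
    neg1^ (∣ A ─ B ∣ ℕ.+ ∣ B' ─ A' ∣) * v B B'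

Is2Additive : ∀ {n} → SetFun₂ n → Set
Is2Additive {n} v = ∀ (A B : Subset n) → Disjoint A B → ∣ B ∣ ℕ.< n ∸ 2 → mobius v A B ≡ 0ℚ

Δ : ∀ {n} → Subset n → Subset n → SetFun₂ n → SetFun₂ n
Δ {n} S T v K L =
  sumL (filter (_⊆? S) (allSubsets n)) λ S' →
  sumL (filter (_⊆? T) (allSubsets n)) λ T' →
    neg1^ ((∣ S ∣ ∸ ∣ S' ∣) ℕ.+ (∣ T ∣ ∸ ∣ T' ∣)) * v (K ∪ S') (L ─ T')

coeff : ℕ → ℕ → ℚ
coeff m k = (+ ((m ∸ k) ! ℕ.* k !)) / (suc m !) where instance _ = suc m !≢0

interaction : ∀ {n} → SetFun₂ n → SetFun₂ n
interaction {n} v S T =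
  sumL (filter (_⊆? ∁ (S ∪ T)) (allSubsets n)) λ K →
    coeff (n ∸ ∣ S ∣ ∸ ∣ T ∣) ∣ K ∣ * Δ S T v K (∁ (K ∪ S))

pair : ∀ {n} → Fin n → Fin n → Subset n
pair i j = ⁅ i ⁆ ∪ ⁅ j ⁆

sumNeq : ∀ {n} → Fin n → (Fin n → ℚ) → ℚ
sumNeq {n} i f = sumL (filter (λ j → ¬? (j ≟ i)) (allFin n)) f

{-# OPTIONS --safe #-}
module Submission where

-- Both transforms are signed sums over pairs of subsets whose signs factor over the elements
-- of N, so removing one element gives a recursion for each. Comparing the two recursions by
-- induction on n writes every interaction index as I_{S,T} = Σ_{B,B'} ω_{S,T}(B,B') m(B,B'),
-- where ω_{S,T}(B,B') = 1/(r+1) with r = n - |S| - |T| - |B'| if S ⊆ B, B ∩ T = ∅ and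
-- B' ∩ (S ∪ T) = ∅, and 0 otherwise. If v is 2-additive only the terms with |B'| ≥ n - 2
-- survive, so r + |S| + |T| ≤ 2. For |S| + |T| = 2 this leaves m(S, N∖(S∪T)) alone; for
-- |S| + |T| = 1 the terms with r = 1 carry weight ½, and summed over j ∉ S ∪ T they are exactly
-- the pair indices I_{S∪{j},T} + I_{S,T∪{j}}.

open import Defs
open import Data.Nat as ℕ using (ℕ; zero; suc; _∸_; _≤_; _!)
import Data.Nat.Properties as ℕₚ
open import Data.Nat.Properties using (_!≢0)
open import Data.Nat.Tactic.RingSolver using (solve-∀)
import Data.Integer as ℤ
import Data.Integer.Properties as ℤₚ
open import Data.Bool using (Bool; true; false; not; _∧_; _∨_)
open import Data.Bool.Properties using (∧-identityʳ; ∧-comm)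
open import Data.Empty using (⊥; ⊥-elim)
open import Data.Fin using (Fin; zero; suc)
open import Data.Fin.Properties using (_≟_)
open import Data.Fin.Subset using (Subset; _∪_; _∩_; _─_; ∁; ∣_∣; ⁅_⁆) renaming (⊥ to ∅)
open import Data.Fin.Subset.Properties
  using (_⊆?_; p⊆q⇒∣p∣≤∣q∣; ∣∁p∣≡n∸∣p∣; ∣⁅x⁆∣≡1; ∣⊥∣≡0; ∪-identityˡ; ∪-identityʳ)
open import Data.Vec using ([]; _∷_; lookup)
open import Data.Vec.Properties using (∷-injectiveʳ; lookup-map)
open import Data.List using (List; []; _∷_; _++_; map; filter; tabulate; allFin)
open import Data.Rational using (ℚ; 0ℚ; 1ℚ; ½; _+_; _-_; _*_; -_; _/_; fromℚᵘ)
import Data.Rational.Properties as ℚₚ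
open import Data.Rational.Solver using (module +-*-Solver)
open import Data.Rational.Unnormalised as ℚᵘ using (mkℚᵘ; *≡*)
import Data.Rational.Unnormalised.Properties as ℚᵘₚ
open import Data.Product using (_×_; _,_)
open import Function using (_∘_; id)
open import Relation.Binary.PropositionalEquality
open import Relation.Nullary using (yes; no; does)
open import Relation.Nullary.Decidable using (_×-dec_; ¬?)
open import Relation.Unary using (Pred; Decidable)

open +-*-Solver using (solve; _:=_; _:+_; _:-_; _:*_; :-_; con)

when : Bool → ℚ → ℚ
when true  q = q
when false _ = 0ℚ

when-0 : ∀ b → when b 0ℚ ≡ 0ℚ
when-0 true  = refl
when-0 false = refl

when-+ : ∀ b x y → when b x + when b y ≡ when b (x + y)
when-+ true  x y = refl
when-+ false x y = ℚₚ.+-identityˡ 0ℚ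

when-* : ∀ b x y → when b (x * y) ≡ when b x * y
when-* true  x y = refl
when-* false x y = sym (ℚₚ.*-zeroˡ y)

when-− : ∀ b x y → when b (x - y) ≡ when b x - when b y
when-− true  x y = refl
when-− false x y = refl

module _ {a} {A : Set a} where

  sum-cong : ∀ (xs : List A) {f g : A → ℚ} → (∀ x → f x ≡ g x) → sumL xs f ≡ sumL xs g
  sum-cong []       f≗g = refl
  sum-cong (x ∷ xs) f≗g = cong₂ _+_ (f≗g x) (sum-cong xs f≗g)

  sum-zero : ∀ (xs : List A) → sumL xs (λ _ → 0ℚ) ≡ 0ℚ
  sum-zero []       = refl
  sum-zero (x ∷ xs) = trans (ℚₚ.+-identityˡ _) (sum-zero xs)

  sum-+ : ∀ (xs : List A) (f g : A → ℚ) → sumL xs (λ x → f x + g x) ≡ sumL xs f + sumL xs g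
  sum-+ []       f g = refl
  sum-+ (x ∷ xs) f g rewrite sum-+ xs f g =
    solve 4 (λ a b c d → (a :+ b) :+ (c :+ d) := (a :+ c) :+ (b :+ d)) refl (f x) (g x) (sumL xs f) (sumL xs g)

  sum-− : ∀ (xs : List A) (f g : A → ℚ) → sumL xs (λ x → f x - g x) ≡ sumL xs f - sumL xs g
  sum-− []       f g = refl
  sum-− (x ∷ xs) f g rewrite sum-− xs f g =
    solve 4 (λ a b c d → (a :- b) :+ (c :- d) := (a :+ c) :- (b :+ d)) refl (f x) (g x) (sumL xs f) (sumL xs g)

  sum-neg : ∀ (xs : List A) (f : A → ℚ) → sumL xs (λ x → - f x) ≡ - sumL xs f
  sum-neg []       f = refl
  sum-neg (x ∷ xs) f rewrite sum-neg xs f = sym (ℚₚ.neg-distrib-+ (f x) (sumL xs f))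

  sum-*ˡ : ∀ (xs : List A) c (f : A → ℚ) → sumL xs (λ x → c * f x) ≡ c * sumL xs f
  sum-*ˡ []       c f = sym (ℚₚ.*-zeroʳ c)
  sum-*ˡ (x ∷ xs) c f rewrite sum-*ˡ xs c f = sym (ℚₚ.*-distribˡ-+ c (f x) (sumL xs f))

  sum-*ʳ : ∀ (xs : List A) (f : A → ℚ) c → sumL xs (λ x → f x * c) ≡ sumL xs f * c
  sum-*ʳ []       f c = sym (ℚₚ.*-zeroˡ c)
  sum-*ʳ (x ∷ xs) f c rewrite sum-*ʳ xs f c = sym (ℚₚ.*-distribʳ-+ c (f x) (sumL xs f))

  sum-++ : ∀ (xs ys : List A) (f : A → ℚ) → sumL (xs ++ ys) f ≡ sumL xs f + sumL ys f
  sum-++ []       ys f = sym (ℚₚ.+-identityˡ _)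
  sum-++ (x ∷ xs) ys f rewrite sum-++ xs ys f = sym (ℚₚ.+-assoc (f x) _ _)

  sum-filter : ∀ {p} {P : Pred A p} (P? : Decidable P) (xs : List A) (f : A → ℚ) →
    sumL (filter P? xs) f ≡ sumL xs (λ x → when (does (P? x)) (f x))
  sum-filter P? []       f = refl
  sum-filter P? (x ∷ xs) f with does (P? x)
  ... | true  = cong (f x +_) (sum-filter P? xs f)
  ... | false = trans (sum-filter P? xs f) (sym (ℚₚ.+-identityˡ _))

  when-sum : ∀ b (xs : List A) (f : A → ℚ) → when b (sumL xs f) ≡ sumL xs (λ x → when b (f x))
  when-sum true  xs f = refl
  when-sum false xs f = sym (sum-zero xs)

sum-filter-cong : ∀ {a p} {A : Set a} {P : Pred A p} (P? : Decidable P) (xs : List A) {f g : A → ℚ} →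
  (∀ x → P x → f x ≡ g x) → sumL (filter P? xs) f ≡ sumL (filter P? xs) g
sum-filter-cong P? []       f≗g = refl
sum-filter-cong P? (x ∷ xs) f≗g with P? x
... | yes px = cong₂ _+_ (f≗g x px) (sum-filter-cong P? xs f≗g)
... | no  _  = sum-filter-cong P? xs f≗g

module _ {a b} {A : Set a} {B : Set b} where

  sum-map : ∀ (g : A → B) (xs : List A) (f : B → ℚ) → sumL (map g xs) f ≡ sumL xs (f ∘ g)
  sum-map g []       f = refl
  sum-map g (x ∷ xs) f = cong (f (g x) +_) (sum-map g xs f)

  sum-swap : ∀ (xs : List A) (ys : List B) (f : A → B → ℚ) →
    sumL xs (λ x → sumL ys (f x)) ≡ sumL ys (λ y → sumL xs (λ x → f x y))
  sum-swap []       ys f = sym (sum-zero ys)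
  sum-swap (x ∷ xs) ys f rewrite sum-swap xs ys f = sym (sum-+ ys (f x) _)

ΣS : ∀ n → (Subset n → ℚ) → ℚ
ΣS n = sumL (allSubsets n)

ΣS-∷ : ∀ n (f : Subset (suc n) → ℚ) → ΣS (suc n) f ≡ ΣS n (f ∘ (false ∷_)) + ΣS n (f ∘ (true ∷_))
ΣS-∷ n f = trans (sum-++ (map (false ∷_) (allSubsets n)) _ f)
  (cong₂ _+_ (sum-map (false ∷_) (allSubsets n) f) (sum-map (true ∷_) (allSubsets n) f))

ΣS-point : ∀ n (f : Subset n → ℚ) X₀ → (∀ X → X ≢ X₀ → f X ≡ 0ℚ) → ΣS n f ≡ f X₀
ΣS-point zero    f [] _ = ℚₚ.+-identityʳ (f [])
ΣS-point (suc n) f (false ∷ X₀) f≡0 = begin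
  ΣS (suc n) f
    ≡⟨ ΣS-∷ n f ⟩
  ΣS n (f ∘ (false ∷_)) + ΣS n (f ∘ (true ∷_))
    ≡⟨ cong₂ _+_ (ΣS-point n (f ∘ (false ∷_)) X₀ λ X X≢X₀ → f≡0 (false ∷ X) (X≢X₀ ∘ ∷-injectiveʳ))
                 (trans (sum-cong (allSubsets n) λ X → f≡0 (true ∷ X) λ ()) (sum-zero (allSubsets n))) ⟩
  f (false ∷ X₀) + 0ℚ
    ≡⟨ ℚₚ.+-identityʳ _ ⟩
  f (false ∷ X₀) ∎
  where open ≡-Reasoning
ΣS-point (suc n) f (true ∷ X₀) f≡0 = begin
  ΣS (suc n) f
    ≡⟨ ΣS-∷ n f ⟩
  ΣS n (f ∘ (false ∷_)) + ΣS n (f ∘ (true ∷_))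
    ≡⟨ cong₂ _+_ (trans (sum-cong (allSubsets n) λ X → f≡0 (false ∷ X) λ ()) (sum-zero (allSubsets n)))
                 (ΣS-point n (f ∘ (true ∷_)) X₀ λ X X≢X₀ → f≡0 (true ∷ X) (X≢X₀ ∘ ∷-injectiveʳ)) ⟩
  0ℚ + f (true ∷ X₀)
    ≡⟨ ℚₚ.+-identityˡ _ ⟩
  f (true ∷ X₀) ∎
  where open ≡-Reasoning

Σ² : ∀ n → (Subset n → Subset n → ℚ) → ℚ
Σ² n F = ΣS n λ B → ΣS n λ B' → F B B'

module _ (n : ℕ) where

  Σ²-cong : ∀ {F G : Subset n → Subset n → ℚ} → (∀ B B' → F B B' ≡ G B B') → Σ² n F ≡ Σ² n G
  Σ²-cong F≗G = sum-cong (allSubsets n) λ B → sum-cong (allSubsets n) (F≗G B)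

  Σ²-+ : ∀ (F G : Subset n → Subset n → ℚ) → Σ² n (λ B B' → F B B' + G B B') ≡ Σ² n F + Σ² n G
  Σ²-+ F G = trans (sum-cong (allSubsets n) λ B → sum-+ (allSubsets n) (F B) (G B))
                   (sum-+ (allSubsets n) (λ B → ΣS n (F B)) (λ B → ΣS n (G B)))

  Σ²-− : ∀ (F G : Subset n → Subset n → ℚ) → Σ² n (λ B B' → F B B' - G B B') ≡ Σ² n F - Σ² n G
  Σ²-− F G = trans (sum-cong (allSubsets n) λ B → sum-− (allSubsets n) (F B) (G B))
                   (sum-− (allSubsets n) (λ B → ΣS n (F B)) (λ B → ΣS n (G B)))

  Σ²-*ˡ : ∀ c (F : Subset n → Subset n → ℚ) → Σ² n (λ B B' → c * F B B') ≡ c * Σ² n F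
  Σ²-*ˡ c F = trans (sum-cong (allSubsets n) λ B → sum-*ˡ (allSubsets n) c (F B))
                    (sum-*ˡ (allSubsets n) c (λ B → ΣS n (F B)))

  Σ²-zeroˡ : ∀ (F : Subset n → Subset n → ℚ) → Σ² n (λ B B' → 0ℚ * F B B') ≡ 0ℚ
  Σ²-zeroˡ F = trans (sum-cong (allSubsets n) λ B → trans (sum-cong (allSubsets n) λ B' → ℚₚ.*-zeroˡ (F B B'))
                                                          (sum-zero (allSubsets n)))
                     (sum-zero (allSubsets n))

  Σ²-neg-*ˡ : ∀ (F G : Subset n → Subset n → ℚ) → Σ² n (λ B B' → - F B B' * G B B') ≡ - Σ² n (λ B B' → F B B' * G B B')
  Σ²-neg-*ˡ F G = trans (sum-cong (allSubsets n) λ B →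
                          trans (sum-cong (allSubsets n) λ B' → sym (ℚₚ.neg-distribˡ-* (F B B') (G B B')))
                                (sum-neg (allSubsets n) (λ B' → F B B' * G B B')))
                        (sum-neg (allSubsets n) (λ B → ΣS n (λ B' → F B B' * G B B')))

Σ²-∷ : ∀ n (F : Subset (suc n) → Subset (suc n) → ℚ) → Σ² (suc n) F ≡
  (Σ² n (λ B B' → F (false ∷ B) (false ∷ B')) + Σ² n (λ B B' → F (false ∷ B) (true ∷ B'))) +
  (Σ² n (λ B B' → F (true ∷ B) (false ∷ B')) + Σ² n (λ B B' → F (true ∷ B) (true ∷ B')))
Σ²-∷ n F = trans (ΣS-∷ n (λ B → ΣS (suc n) (F B))) (cong₂ _+_ (row false) (row true))
  where
  row : ∀ b → ΣS n (λ B → ΣS (suc n) (F (b ∷ B))) ≡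
              Σ² n (λ B B' → F (b ∷ B) (false ∷ B')) + Σ² n (λ B B' → F (b ∷ B) (true ∷ B'))
  row b = trans (sum-cong (allSubsets n) λ B → ΣS-∷ n (F (b ∷ B)))
                (sum-+ (allSubsets n) (λ B → ΣS n λ B' → F (b ∷ B) (false ∷ B')) (λ B → ΣS n λ B' → F (b ∷ B) (true ∷ B')))

Σ²-point : ∀ n (F : Subset n → Subset n → ℚ) B₀ B₀' →
  (∀ B B' → (B ≡ B₀ → B' ≡ B₀' → ⊥) → F B B' ≡ 0ℚ) → Σ² n F ≡ F B₀ B₀'
Σ²-point n F B₀ B₀' F≡0 = trans
  (ΣS-point n (λ B → ΣS n (F B)) B₀ λ B B≢B₀ →
    trans (sum-cong (allSubsets n) λ B' → F≡0 B B' λ B≡B₀ _ → B≢B₀ B≡B₀) (sum-zero (allSubsets n)))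
  (ΣS-point n (F B₀) B₀' λ B' B'≢B₀' → F≡0 B₀ B' λ _ → B'≢B₀')

Σ²-filter : ∀ {n p q} {P : Pred (Subset n) p} {Q : Pred (Subset n) q} (P? : Decidable P) (Q? : Decidable Q)
  (sign g : Subset n → Subset n → ℚ) →
  sumL (filter P? (allSubsets n)) (λ B → sumL (filter Q? (allSubsets n)) λ B' → sign B B' * g B B') ≡
  Σ² n (λ B B' → when (does (P? B)) (when (does (Q? B')) (sign B B')) * g B B')
Σ²-filter {n} P? Q? sign g = trans (sum-filter P? (allSubsets n) _) (sum-cong (allSubsets n) λ B →
  trans (cong (when (does (P? B))) (sum-filter Q? (allSubsets n) _))
  (trans (when-sum (does (P? B)) (allSubsets n) _) (sum-cong (allSubsets n) λ B' →
  trans (cong (when (does (P? B))) (when-* (does (Q? B')) (sign B B') (g B B')))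
        (when-* (does (P? B)) _ (g B B')))))

slice : ∀ {n} → SetFun₂ (suc n) → Bool → Bool → SetFun₂ n
slice v b b' B B' = v (b ∷ B) (b' ∷ B')

Σ²-factor-∷ : ∀ n (K : Subset (suc n) → Subset (suc n) → ℚ) (h : Bool → Bool → ℚ) (K' : Subset n → Subset n → ℚ) →
  (∀ b b' B B' → K (b ∷ B) (b' ∷ B') ≡ h b b' * K' B B') → ∀ (u : SetFun₂ (suc n)) →
  Σ² (suc n) (λ B B' → K B B' * u B B') ≡
    (h false false * Σ² n (λ B B' → K' B B' * slice u false false B B') +
     h false true  * Σ² n (λ B B' → K' B B' * slice u false true B B')) +
    (h true false  * Σ² n (λ B B' → K' B B' * slice u true false B B') +
     h true true   * Σ² n (λ B B' → K' B B' * slice u true true B B'))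
Σ²-factor-∷ n K h K' K≡ u = trans (Σ²-∷ n (λ B B' → K B B' * u B B'))
  (cong₂ _+_ (cong₂ _+_ (quarter false false) (quarter false true))
                                                         (cong₂ _+_ (quarter true false) (quarter true true)))
  where
  quarter : ∀ b b' → Σ² n (λ B B' → K (b ∷ B) (b' ∷ B') * u (b ∷ B) (b' ∷ B')) ≡
                     h b b' * Σ² n (λ B B' → K' B B' * slice u b b' B B')
  quarter b b' = trans (Σ²-cong n λ B B' → trans (cong (_* u (b ∷ B) (b' ∷ B')) (K≡ b b' B B'))
                                                (ℚₚ.*-assoc (h b b') (K' B B') _))
                       (Σ²-*ˡ n (h b b') _)

ΣF : ∀ n → (Fin n → ℚ) → ℚ
ΣF zero    f = 0ℚ
ΣF (suc n) f = f zero + ΣF n (f ∘ suc)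

ΣF-cong : ∀ n {f g : Fin n → ℚ} → (∀ j → f j ≡ g j) → ΣF n f ≡ ΣF n g
ΣF-cong zero    f≗g = refl
ΣF-cong (suc n) f≗g = cong₂ _+_ (f≗g zero) (ΣF-cong n (f≗g ∘ suc))

ΣF-+ : ∀ n (f g : Fin n → ℚ) → ΣF n (λ j → f j + g j) ≡ ΣF n f + ΣF n g
ΣF-+ zero    f g = sym (ℚₚ.+-identityˡ 0ℚ)
ΣF-+ (suc n) f g rewrite ΣF-+ n (f ∘ suc) (g ∘ suc) =
  solve 4 (λ a b c d → (a :+ b) :+ (c :+ d) := (a :+ c) :+ (b :+ d)) refl (f zero) (g zero) _ _

ΣF-zero : ∀ n → ΣF n (λ _ → 0ℚ) ≡ 0ℚ
ΣF-zero zero    = refl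
ΣF-zero (suc n) = trans (ℚₚ.+-identityˡ _) (ΣF-zero n)

ΣF-point : ∀ n (i : Fin n) (f : Fin n → ℚ) → ΣF n (λ j → when (does (j ≟ i)) (f j)) ≡ f i
ΣF-point (suc n) zero    f = trans (cong (f zero +_) (ΣF-zero n)) (ℚₚ.+-identityʳ (f zero))
ΣF-point (suc n) (suc i) f = trans (ℚₚ.+-identityˡ _) (ΣF-point n i (f ∘ suc))

sum-tabulate : ∀ {a} {A : Set a} n (g : Fin n → A) (f : A → ℚ) → sumL (tabulate g) f ≡ ΣF n (f ∘ g)
sum-tabulate zero    g f = refl
sum-tabulate (suc n) g f = cong (f (g zero) +_) (sum-tabulate n (g ∘ suc) f)

sumNeq-insert : ∀ n (i : Fin n) (f : Fin n → ℚ) → sumNeq i f + f i ≡ ΣF n f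
sumNeq-insert n i f = begin
  sumNeq i f + f i
    ≡⟨ cong₂ _+_ (trans (sum-filter (λ j → ¬? (j ≟ i)) (allFin n) f) (sum-tabulate n id _)) (sym (ΣF-point n i f)) ⟩
  ΣF n (λ j → when (not (does (j ≟ i))) (f j)) + ΣF n (λ j → when (does (j ≟ i)) (f j))
    ≡⟨ sym (ΣF-+ n _ _) ⟩
  ΣF n (λ j → when (not (does (j ≟ i))) (f j) + when (does (j ≟ i)) (f j))
    ≡⟨ ΣF-cong n (λ j → split (does (j ≟ i)) (f j)) ⟩
  ΣF n f ∎
  where
  open ≡-Reasoning
  split : ∀ b x → when (not b) x + when b x ≡ x
  split true  x = ℚₚ.+-identityˡ x
  split false x = ℚₚ.+-identityʳ x

fromℕ : ℕ → ℚ
fromℕ zero    = 0ℚ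
fromℕ (suc k) = 1ℚ + fromℕ k

ΣF-count : ∀ n (X : Subset n) → ΣF n (λ j → when (lookup X j) 1ℚ) ≡ fromℕ ∣ X ∣
ΣF-count zero    []          = refl
ΣF-count (suc n) (true ∷ X)  = cong (1ℚ +_) (ΣF-count n X)
ΣF-count (suc n) (false ∷ X) = trans (ℚₚ.+-identityˡ _) (ΣF-count n X)

sumNeq-count-∉ : ∀ n (i : Fin n) (X : Subset n) r → lookup X i ≡ false → r ℕ.+ (∣ X ∣ ℕ.+ 1) ≡ n →
  sumNeq i (λ j → when (not (lookup X j)) 1ℚ) ≡ fromℕ r
sumNeq-count-∉ n i X r i∉X size = begin
  sumNeq i f
    ≡⟨ solve 1 (λ x → x := (x :+ con 1ℚ) :- con 1ℚ) refl (sumNeq i f) ⟩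
  (sumNeq i f + 1ℚ) - 1ℚ
    ≡⟨ cong (λ x → (sumNeq i f + when (not x) 1ℚ) - 1ℚ) i∉X ⟨
  (sumNeq i f + f i) - 1ℚ
    ≡⟨ cong (_- 1ℚ) (sumNeq-insert n i f) ⟩
  ΣF n f - 1ℚ
    ≡⟨ cong (_- 1ℚ) (ΣF-cong n λ j → cong (λ b → when b 1ℚ) (lookup-map j not X)) ⟨
  ΣF n (λ j → when (lookup (∁ X) j) 1ℚ) - 1ℚ
    ≡⟨ cong (_- 1ℚ) (trans (ΣF-count n (∁ X)) (cong fromℕ (trans (∣∁p∣≡n∸∣p∣ X) n∸∣X∣≡1+r))) ⟩
  (1ℚ + fromℕ r) - 1ℚ
    ≡⟨ solve 1 (λ x → (con 1ℚ :+ x) :- con 1ℚ := x) refl (fromℕ r) ⟩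
  fromℕ r ∎
  where
  open ≡-Reasoning
  f : Fin n → ℚ
  f j = when (not (lookup X j)) 1ℚ
  n∸∣X∣≡1+r : n ∸ ∣ X ∣ ≡ suc r
  n∸∣X∣≡1+r = begin
    n ∸ ∣ X ∣                       ≡⟨ cong (_∸ ∣ X ∣) size ⟨
    r ℕ.+ (∣ X ∣ ℕ.+ 1) ∸ ∣ X ∣     ≡⟨ cong (λ k → r ℕ.+ k ∸ ∣ X ∣) (ℕₚ.+-comm ∣ X ∣ 1) ⟩
    r ℕ.+ suc ∣ X ∣ ∸ ∣ X ∣         ≡⟨ cong (_∸ ∣ X ∣) (ℕₚ.+-suc r ∣ X ∣) ⟩
    suc r ℕ.+ ∣ X ∣ ∸ ∣ X ∣         ≡⟨ ℕₚ.m+n∸n≡m (suc r) ∣ X ∣ ⟩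
    suc r                           ∎

Σ²-sumNeq : ∀ {n} (i : Fin n) (F : Fin n → Subset n → Subset n → ℚ) (m : SetFun₂ n) →
  sumNeq i (λ j → Σ² n (λ B B' → F j B B' * m B B')) ≡ Σ² n (λ B B' → sumNeq i (λ j → F j B B') * m B B')
Σ²-sumNeq {n} i F m =
  trans (sum-swap others (allSubsets n) (λ j B → ΣS n (λ B' → F j B B' * m B B')))
        (sum-cong (allSubsets n) λ B → trans (sum-swap others (allSubsets n) (λ j B' → F j B B' * m B B'))
                                             (sum-cong (allSubsets n) λ B' → sum-*ʳ others (λ j → F j B B') (m B B')))
  where
  others = filter (λ j → ¬? (j ≟ i)) (allFin n)

-- The Möbius transform, one element at a time

neg1^-+suc : ∀ x y → neg1^ (x ℕ.+ suc y) ≡ - neg1^ (x ℕ.+ y)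
neg1^-+suc x y = cong neg1^ (ℕₚ.+-suc x y)

when²-neg : ∀ b c x → when b (when c (- x)) ≡ - 1ℚ * when b (when c x)
when²-neg true  true  x = solve 1 (λ a → :- a := (:- con 1ℚ) :* a) refl x
when²-neg true  false x = refl
when²-neg false c     x = refl

mobiusSign : ∀ {n} → Subset n → Subset n → Subset n → Subset n → ℚ
mobiusSign A A' B B' =
  when (does (B ⊆? A)) (when (does (A' ⊆? B') ∧ does (B' ⊆? ∁ A)) (neg1^ (∣ A ─ B ∣ ℕ.+ ∣ B' ─ A' ∣)))

mobius-Σ² : ∀ {n} (v : SetFun₂ n) A A' → mobius v A A' ≡ Σ² n (λ B B' → mobiusSign A A' B B' * v B B')
mobius-Σ² {n} v A A' = Σ²-filter (_⊆? A) (λ B' → (A' ⊆? B') ×-dec (B' ⊆? ∁ A))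
                                 (λ B B' → neg1^ (∣ A ─ B ∣ ℕ.+ ∣ B' ─ A' ∣)) v

mobiusStep : Bool → Bool → Bool → Bool → ℚ
mobiusStep false false false false = 1ℚ
mobiusStep false false false true  = - 1ℚ
mobiusStep false true  false true  = 1ℚ
mobiusStep true  false true  false = 1ℚ
mobiusStep true  false false false = - 1ℚ
mobiusStep _     _     _     _     = 0ℚ

mobiusSign-∷ : ∀ {n} a a' b b' (A A' B B' : Subset n) →
  mobiusSign (a ∷ A) (a' ∷ A') (b ∷ B) (b' ∷ B') ≡ mobiusStep a a' b b' * mobiusSign A A' B B'
mobiusSign-∷ a a' b b' A A' B B' = step a a' b b'
  where
  B⊆A = does (B ⊆? A)
  A'⊆B'⊆∁A = does (A' ⊆? B') ∧ does (B' ⊆? ∁ A)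
  σ = mobiusSign A A' B B'
  unit : σ ≡ 1ℚ * σ
  unit = sym (ℚₚ.*-identityˡ σ)
  null : ∀ {x} → x ≡ 0ℚ → x ≡ 0ℚ * σ
  null x≡0 = trans x≡0 (sym (ℚₚ.*-zeroˡ σ))
  flip : when B⊆A (when A'⊆B'⊆∁A (neg1^ (suc (∣ A ─ B ∣ ℕ.+ ∣ B' ─ A' ∣)))) ≡ - 1ℚ * σ
  flip = when²-neg B⊆A A'⊆B'⊆∁A _
  A'⊆B'⊆∅ : ∀ x → when B⊆A (when (does (A' ⊆? B') ∧ false) x) ≡ 0ℚ
  A'⊆B'⊆∅ x with does (A' ⊆? B')
  ... | true  = when-0 B⊆A
  ... | false = when-0 B⊆A
  step : ∀ a a' b b' → mobiusSign (a ∷ A) (a' ∷ A') (b ∷ B) (b' ∷ B') ≡ mobiusStep a a' b b' * σ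
  step false false false false = unit
  step false false false true  =
    trans (cong (when B⊆A ∘ when A'⊆B'⊆∁A) (neg1^-+suc ∣ A ─ B ∣ ∣ B' ─ A' ∣)) flip
  step false false true  false = null refl
  step false false true  true  = null refl
  step false true  false false = null (when-0 B⊆A)
  step false true  false true  = unit
  step false true  true  false = null refl
  step false true  true  true  = null refl
  step true  false true  false = unit
  step true  false false false = flip
  step true  false false true  = null (A'⊆B'⊆∅ _)
  step true  false true  true  = null (A'⊆B'⊆∅ _)
  step true  true  false false = null (when-0 B⊆A)
  step true  true  true  false = null (when-0 B⊆A)
  step true  true  false true  = null (A'⊆B'⊆∅ _)
  step true  true  true  true  = null (A'⊆B'⊆∅ _)

mobius-∷ : ∀ n (v : SetFun₂ (suc n)) a a' A A' → mobius v (a ∷ A) (a' ∷ A') ≡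
  (mobiusStep a a' false false * mobius (slice v false false) A A' +
   mobiusStep a a' false true  * mobius (slice v false true) A A') +
  (mobiusStep a a' true false  * mobius (slice v true false) A A' +
   mobiusStep a a' true true   * mobius (slice v true true) A A')
mobius-∷ n v a a' A A' = begin
  mobius v (a ∷ A) (a' ∷ A')
    ≡⟨ mobius-Σ² v (a ∷ A) (a' ∷ A') ⟩
  Σ² (suc n) (λ B B' → mobiusSign (a ∷ A) (a' ∷ A') B B' * v B B')
    ≡⟨ Σ²-factor-∷ n (mobiusSign (a ∷ A) (a' ∷ A')) (mobiusStep a a') (mobiusSign A A')
                     (λ b b' → mobiusSign-∷ a a' b b' A A') v ⟩
  _ ≡⟨ sym (cong₂ _+_ (cong₂ _+_ (rest false false) (rest false true)) (cong₂ _+_ (rest true false) (rest true true))) ⟩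
  _ ∎
  where
  open ≡-Reasoning
  rest : ∀ b b' → mobiusStep a a' b b' * mobius (slice v b b') A A' ≡
                  mobiusStep a a' b b' * Σ² n (λ B B' → mobiusSign A A' B B' * slice v b b' B B')
  rest b b' = cong (mobiusStep a a' b b' *_) (mobius-Σ² (slice v b b') A A')

module _ (n : ℕ) (v : SetFun₂ (suc n)) (A A' : Subset n) where
  private
    M : Bool → Bool → ℚ
    M b b' = mobius (slice v b b') A A'

  mobius-tf : mobius v (true ∷ A) (false ∷ A') ≡ M true false - M false false
  mobius-tf = trans (mobius-∷ n v true false A A')
    (solve 4 (λ a b c d → (:- con 1ℚ :* a :+ con 0ℚ :* b) :+ (con 1ℚ :* c :+ con 0ℚ :* d) := c :- a)
           refl (M false false) (M false true) (M true false) (M true true))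

  mobius-ft : mobius v (false ∷ A) (true ∷ A') ≡ M false true
  mobius-ft = trans (mobius-∷ n v false true A A')
    (solve 4 (λ a b c d → (con 0ℚ :* a :+ con 1ℚ :* b) :+ (con 0ℚ :* c :+ con 0ℚ :* d) := b)
           refl (M false false) (M false true) (M true false) (M true true))

  mobius-ff : mobius v (false ∷ A) (false ∷ A') ≡ M false false - M false true
  mobius-ff = trans (mobius-∷ n v false false A A')
    (solve 4 (λ a b c d → (con 1ℚ :* a :+ :- con 1ℚ :* b) :+ (con 0ℚ :* c :+ con 0ℚ :* d) := a :- b)
           refl (M false false) (M false true) (M true false) (M true true))

  mobius-tt : mobius v (true ∷ A) (true ∷ A') ≡ 0ℚ
  mobius-tt = trans (mobius-∷ n v true true A A')
    (solve 4 (λ a b c d → (con 0ℚ :* a :+ con 0ℚ :* b) :+ (con 0ℚ :* c :+ con 0ℚ :* d) := con 0ℚ)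
           refl (M false false) (M false true) (M true false) (M true true))

disjointᵇ : ∀ {n} → Subset n → Subset n → Bool
disjointᵇ []      []      = true
disjointᵇ (x ∷ X) (y ∷ Y) = not (x ∧ y) ∧ disjointᵇ X Y

disjointᵇ⇒∩≡∅ : ∀ {n} (B B' : Subset n) → disjointᵇ B B' ≡ true → B ∩ B' ≡ ∅
disjointᵇ⇒∩≡∅ []          []           _ = refl
disjointᵇ⇒∩≡∅ (true ∷ B)  (true ∷ B')  ()
disjointᵇ⇒∩≡∅ (true ∷ B)  (false ∷ B') d = cong (false ∷_) (disjointᵇ⇒∩≡∅ B B' d)
disjointᵇ⇒∩≡∅ (false ∷ B) (_ ∷ B')     d = cong (false ∷_) (disjointᵇ⇒∩≡∅ B B' d)

mobius-overlap : ∀ n (v : SetFun₂ n) B B' → disjointᵇ B B' ≡ false → mobius v B B' ≡ 0ℚ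
mobius-overlap zero    v []          []           ()
mobius-overlap (suc n) v (true ∷ B)  (true ∷ B')  _ = mobius-tt n v B B'
mobius-overlap (suc n) v (true ∷ B)  (false ∷ B') d =
  trans (mobius-tf n v B B') (cong₂ _-_ (mobius-overlap n _ B B' d) (mobius-overlap n _ B B' d))
mobius-overlap (suc n) v (false ∷ B) (true ∷ B')  d = trans (mobius-ft n v B B') (mobius-overlap n _ B B' d)
mobius-overlap (suc n) v (false ∷ B) (false ∷ B') d =
  trans (mobius-ff n v B B') (cong₂ _-_ (mobius-overlap n _ B B' d) (mobius-overlap n _ B B' d))

Σ²-mobius-∷ : ∀ n (K : Subset (suc n) → Subset (suc n) → ℚ) (c₀₀ c₀₁ c₁₀ : Subset n → Subset n → ℚ) →
  (∀ B B' → K (false ∷ B) (false ∷ B') - K (true ∷ B) (false ∷ B') ≡ c₀₀ B B') →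
  (∀ B B' → K (false ∷ B) (true ∷ B') - K (false ∷ B) (false ∷ B') ≡ c₀₁ B B') →
  (∀ B B' → K (true ∷ B) (false ∷ B') ≡ c₁₀ B B') → ∀ (v : SetFun₂ (suc n)) →
  Σ² (suc n) (λ B B' → K B B' * mobius v B B') ≡
    (Σ² n (λ B B' → c₀₀ B B' * mobius (slice v false false) B B') +
     Σ² n (λ B B' → c₀₁ B B' * mobius (slice v false true) B B')) +
    Σ² n (λ B B' → c₁₀ B B' * mobius (slice v true false) B B')
Σ²-mobius-∷ n K c₀₀ c₀₁ c₁₀ K₀₀ K₀₁ K₁₀ v = begin
  Σ² (suc n) (λ B B' → K B B' * mobius v B B')
    ≡⟨ Σ²-∷ n (λ B B' → K B B' * mobius v B B') ⟩
  (Σ² n (F false false) + Σ² n (F false true)) + (Σ² n (F true false) + Σ² n (F true true))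
    ≡⟨ sym (trans (Σ²-+ n (λ B B' → F false false B B' + F false true B B') (λ B B' → F true false B B' + F true true B B'))
                  (cong₂ _+_ (Σ²-+ n (F false false) (F false true)) (Σ²-+ n (F true false) (F true true)))) ⟩
  Σ² n (λ B B' → (F false false B B' + F false true B B') + (F true false B B' + F true true B B'))
    ≡⟨ Σ²-cong n regroup ⟩
  Σ² n (λ B B' → (G₀₀ B B' + G₀₁ B B') + G₁₀ B B')
    ≡⟨ trans (Σ²-+ n (λ B B' → G₀₀ B B' + G₀₁ B B') G₁₀) (cong (_+ Σ² n G₁₀) (Σ²-+ n G₀₀ G₀₁)) ⟩
  (Σ² n G₀₀ + Σ² n G₀₁) + Σ² n G₁₀ ∎
  where
  open ≡-Reasoning
  F : Bool → Bool → Subset n → Subset n → ℚ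
  F b b' B B' = K (b ∷ B) (b' ∷ B') * mobius v (b ∷ B) (b' ∷ B')
  M : Bool → Bool → Subset n → Subset n → ℚ
  M b b' = mobius (slice v b b')
  G₀₀ G₀₁ G₁₀ : Subset n → Subset n → ℚ
  G₀₀ B B' = c₀₀ B B' * M false false B B'
  G₀₁ B B' = c₀₁ B B' * M false true B B'
  G₁₀ B B' = c₁₀ B B' * M true false B B'
  peel : ∀ k₀₀ k₀₁ k₁₀ k₁₁ m₀₀ m₀₁ m₁₀ →
    (k₀₀ * (m₀₀ - m₀₁) + k₀₁ * m₀₁) + (k₁₀ * (m₁₀ - m₀₀) + k₁₁ * 0ℚ) ≡
    ((k₀₀ - k₁₀) * m₀₀ + (k₀₁ - k₀₀) * m₀₁) + k₁₀ * m₁₀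
  peel = solve 7 (λ k₀₀ k₀₁ k₁₀ k₁₁ m₀₀ m₀₁ m₁₀ →
             (k₀₀ :* (m₀₀ :- m₀₁) :+ k₀₁ :* m₀₁) :+ (k₁₀ :* (m₁₀ :- m₀₀) :+ k₁₁ :* con 0ℚ) :=
             ((k₀₀ :- k₁₀) :* m₀₀ :+ (k₀₁ :- k₀₀) :* m₀₁) :+ k₁₀ :* m₁₀) refl
  regroup : ∀ B B' → (F false false B B' + F false true B B') + (F true false B B' + F true true B B') ≡
                     (G₀₀ B B' + G₀₁ B B') + G₁₀ B B'
  regroup B B' = begin
    (F false false B B' + F false true B B') + (F true false B B' + F true true B B')
      ≡⟨ cong₂ _+_ (cong₂ _+_ (cong (K (false ∷ B) (false ∷ B') *_) (mobius-ff n v B B'))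
                               (cong (K (false ∷ B) (true ∷ B') *_) (mobius-ft n v B B')))
                    (cong₂ _+_ (cong (K (true ∷ B) (false ∷ B') *_) (mobius-tf n v B B'))
                               (cong (K (true ∷ B) (true ∷ B') *_) (mobius-tt n v B B'))) ⟩
    _ ≡⟨ peel (K (false ∷ B) (false ∷ B')) (K (false ∷ B) (true ∷ B')) (K (true ∷ B) (false ∷ B'))
              (K (true ∷ B) (true ∷ B')) (M false false B B') (M false true B B') (M true false B B') ⟩
    _ ≡⟨ cong₂ _+_ (cong₂ _+_ (cong (_* M false false B B') (K₀₀ B B')) (cong (_* M false true B B') (K₀₁ B B')))
                   (cong (_* M true false B B') (K₁₀ B B')) ⟩
    (G₀₀ B B' + G₀₁ B B') + G₁₀ B B' ∎

-- The interaction transform, one element at a time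

deltaSign : ∀ {n} → Subset n → Subset n → Subset n → Subset n → ℚ
deltaSign S T S' T' = when (does (S' ⊆? S)) (when (does (T' ⊆? T)) (neg1^ ((∣ S ∣ ∸ ∣ S' ∣) ℕ.+ (∣ T ∣ ∸ ∣ T' ∣))))

Δ-Σ² : ∀ {n} S T (v : SetFun₂ n) K L → Δ S T v K L ≡ Σ² n (λ S' T' → deltaSign S T S' T' * v (K ∪ S') (L ─ T'))
Δ-Σ² S T v K L = Σ²-filter (_⊆? S) (_⊆? T) (λ S' T' → neg1^ ((∣ S ∣ ∸ ∣ S' ∣) ℕ.+ (∣ T ∣ ∸ ∣ T' ∣)))
                           (λ S' T' → v (K ∪ S') (L ─ T'))

deltaStep : Bool → Bool → Bool → Bool → ℚ
deltaStep false false false false = 1ℚ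
deltaStep true  false true  false = 1ℚ
deltaStep true  false false false = - 1ℚ
deltaStep false true  false true  = 1ℚ
deltaStep false true  false false = - 1ℚ
deltaStep true  true  true  true  = 1ℚ
deltaStep true  true  false true  = - 1ℚ
deltaStep true  true  true  false = - 1ℚ
deltaStep true  true  false false = 1ℚ
deltaStep _     _     _     _     = 0ℚ

when⊆-suc-∸ : ∀ {n} (S S' : Subset n) (P : ℕ → ℚ) →
  when (does (S' ⊆? S)) (P (suc ∣ S ∣ ∸ ∣ S' ∣)) ≡ when (does (S' ⊆? S)) (P (suc (∣ S ∣ ∸ ∣ S' ∣)))
when⊆-suc-∸ S S' P with S' ⊆? S
... | yes S'⊆S = cong P (ℕₚ.+-∸-assoc 1 (p⊆q⇒∣p∣≤∣q∣ S'⊆S))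
... | no  _    = refl

deltaSign-∷ : ∀ {n} s t s' t' (S T S' T' : Subset n) →
  deltaSign (s ∷ S) (t ∷ T) (s' ∷ S') (t' ∷ T') ≡ deltaStep s t s' t' * deltaSign S T S' T'
deltaSign-∷ s t s' t' S T S' T' = step s t s' t'
  where
  S'⊆S = does (S' ⊆? S)
  T'⊆T = does (T' ⊆? T)
  a = ∣ S ∣ ∸ ∣ S' ∣
  b = ∣ T ∣ ∸ ∣ T' ∣
  σ = deltaSign S T S' T'
  unit : σ ≡ 1ℚ * σ
  unit = sym (ℚₚ.*-identityˡ σ)
  null : ∀ {x} → x ≡ 0ℚ → x ≡ 0ℚ * σ
  null x≡0 = trans x≡0 (sym (ℚₚ.*-zeroˡ σ))
  flipS : when S'⊆S (when T'⊆T (neg1^ ((suc ∣ S ∣ ∸ ∣ S' ∣) ℕ.+ b))) ≡ - 1ℚ * σ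
  flipS = trans (when⊆-suc-∸ S S' (λ x → when T'⊆T (neg1^ (x ℕ.+ b)))) (when²-neg S'⊆S T'⊆T (neg1^ (a ℕ.+ b)))
  flipT : when S'⊆S (when T'⊆T (neg1^ (a ℕ.+ (suc ∣ T ∣ ∸ ∣ T' ∣)))) ≡ - 1ℚ * σ
  flipT = trans (cong (when S'⊆S) (when⊆-suc-∸ T T' (λ y → neg1^ (a ℕ.+ y))))
         (trans (cong (when S'⊆S ∘ when T'⊆T) (neg1^-+suc a b)) (when²-neg S'⊆S T'⊆T (neg1^ (a ℕ.+ b))))
  flipST : when S'⊆S (when T'⊆T (neg1^ ((suc ∣ S ∣ ∸ ∣ S' ∣) ℕ.+ (suc ∣ T ∣ ∸ ∣ T' ∣)))) ≡ 1ℚ * σ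
  flipST = trans (when⊆-suc-∸ S S' (λ x → when T'⊆T (neg1^ (x ℕ.+ (suc ∣ T ∣ ∸ ∣ T' ∣)))))
           (trans (when²-neg S'⊆S T'⊆T (neg1^ (a ℕ.+ (suc ∣ T ∣ ∸ ∣ T' ∣))))
           (trans (cong (- 1ℚ *_) flipT) (solve 1 (λ x → (:- con 1ℚ) :* ((:- con 1ℚ) :* x) := con 1ℚ :* x) refl σ)))
  step : ∀ s t s' t' → deltaSign (s ∷ S) (t ∷ T) (s' ∷ S') (t' ∷ T') ≡ deltaStep s t s' t' * σ
  step false false false false = unit
  step false false false true  = null (when-0 S'⊆S)
  step false false true  false = null refl
  step false false true  true  = null refl
  step true  false true  false = unit
  step true  false false false = flipS
  step true  false true  true  = null (when-0 S'⊆S)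
  step true  false false true  = null (when-0 S'⊆S)
  step false true  false true  = unit
  step false true  false false = flipT
  step false true  true  false = null refl
  step false true  true  true  = null refl
  step true  true  true  true  = unit
  step true  true  false true  = flipS
  step true  true  true  false = flipT
  step true  true  false false = flipST

Δ-∷ : ∀ n s t (S T : Subset n) (v : SetFun₂ (suc n)) k l K L →
  Δ (s ∷ S) (t ∷ T) v (k ∷ K) (l ∷ L) ≡
    (deltaStep s t false false * Δ S T (slice v (k ∨ false) l) K L +
     deltaStep s t false true  * Δ S T (slice v (k ∨ false) false) K L) +
    (deltaStep s t true false  * Δ S T (slice v (k ∨ true) l) K L +
     deltaStep s t true true   * Δ S T (slice v (k ∨ true) false) K L)
Δ-∷ n s t S T v k l K L = begin
  Δ (s ∷ S) (t ∷ T) v (k ∷ K) (l ∷ L)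
    ≡⟨ Δ-Σ² (s ∷ S) (t ∷ T) v (k ∷ K) (l ∷ L) ⟩
  Σ² (suc n) (λ S' T' → deltaSign (s ∷ S) (t ∷ T) S' T' * g S' T')
    ≡⟨ Σ²-factor-∷ n (deltaSign (s ∷ S) (t ∷ T)) (deltaStep s t) (deltaSign S T)
                     (λ s' t' → deltaSign-∷ s t s' t' S T) g ⟩
  _ ≡⟨ sym (cong₂ _+_ (cong₂ _+_ (rest false false l) (rest false true false))
                      (cong₂ _+_ (rest true false l) (rest true true false))) ⟩
  _ ∎
  where
  open ≡-Reasoning
  g : SetFun₂ (suc n)
  g S' T' = v ((k ∷ K) ∪ S') ((l ∷ L) ─ T')
  rest : ∀ b b' l' → deltaStep s t b b' * Δ S T (slice v (k ∨ b) l') K L ≡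
                     deltaStep s t b b' * Σ² n (λ S' T' → deltaSign S T S' T' * slice v (k ∨ b) l' (K ∪ S') (L ─ T'))
  rest b b' l' = cong (deltaStep s t b b' *_) (Δ-Σ² S T (slice v (k ∨ b) l') K L)

module _ (n : ℕ) (v : SetFun₂ (suc n)) (S T K L : Subset n) where
  private
    D : Bool → Bool → ℚ
    D b b' = Δ S T (slice v b b') K L

  Δ-ff-∉ : Δ (false ∷ S) (false ∷ T) v (false ∷ K) (true ∷ L) ≡ D false true
  Δ-ff-∉ = trans (Δ-∷ n false false S T v false true K L)
    (solve 4 (λ a b c d → (con 1ℚ :* a :+ con 0ℚ :* b) :+ (con 0ℚ :* c :+ con 0ℚ :* d) := a)
           refl (D false true) (D false false) (D true true) (D true false))

  Δ-ff-∈ : Δ (false ∷ S) (false ∷ T) v (true ∷ K) (false ∷ L) ≡ D true false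
  Δ-ff-∈ = trans (Δ-∷ n false false S T v true false K L)
    (solve 1 (λ a → (con 1ℚ :* a :+ con 0ℚ :* a) :+ (con 0ℚ :* a :+ con 0ℚ :* a) := a) refl (D true false))

  Δ-tf : Δ (true ∷ S) (false ∷ T) v (false ∷ K) (false ∷ L) ≡ D true false - D false false
  Δ-tf = trans (Δ-∷ n true false S T v false false K L)
    (solve 2 (λ a b → (:- con 1ℚ :* a :+ con 0ℚ :* a) :+ (con 1ℚ :* b :+ con 0ℚ :* b) := b :- a)
           refl (D false false) (D true false))

  Δ-ft : Δ (false ∷ S) (true ∷ T) v (false ∷ K) (true ∷ L) ≡ D false false - D false true
  Δ-ft = trans (Δ-∷ n false true S T v false true K L)
    (solve 4 (λ a b c d → (:- con 1ℚ :* a :+ con 1ℚ :* b) :+ (con 0ℚ :* c :+ con 0ℚ :* d) := b :- a)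
           refl (D false true) (D false false) (D true true) (D true false))

  Δ-tt : Δ (true ∷ S) (true ∷ T) v (false ∷ K) (false ∷ L) ≡ 0ℚ
  Δ-tt = trans (Δ-∷ n true true S T v false false K L)
    (solve 2 (λ a c → (con 1ℚ :* a :+ (:- con 1ℚ) :* a) :+ ((:- con 1ℚ) :* c :+ con 1ℚ :* c) := con 0ℚ)
           refl (D false false) (D true false))

-- The weight (m - k)! k! / (m + 1)! of the interaction transform replaced by any sequence w
-- indexed by |K|: putting the removed element into K shifts the sequence to w ∘ suc.
interactionʷ : ∀ {n} → (ℕ → ℚ) → SetFun₂ n → Subset n → Subset n → ℚ
interactionʷ {n} w v S T = sumL (filter (_⊆? ∁ (S ∪ T)) (allSubsets n)) λ K → w ∣ K ∣ * Δ S T v K (∁ (K ∪ S))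

interactionʷ-summand : ∀ {n} → (ℕ → ℚ) → SetFun₂ n → Subset n → Subset n → Subset n → ℚ
interactionʷ-summand w v S T K = when (does (K ⊆? ∁ (S ∪ T))) (w ∣ K ∣ * Δ S T v K (∁ (K ∪ S)))

interactionʷ-ΣS : ∀ {n} w (v : SetFun₂ n) S T → interactionʷ w v S T ≡ ΣS n (interactionʷ-summand w v S T)
interactionʷ-ΣS {n} w v S T = sum-filter (_⊆? ∁ (S ∪ T)) (allSubsets n) _

interactionʷ-∷ : ∀ n w (v : SetFun₂ (suc n)) s t (S T : Subset n) →
  interactionʷ w v (s ∷ S) (t ∷ T) ≡
    ΣS n (interactionʷ-summand w v (s ∷ S) (t ∷ T) ∘ (false ∷_)) +
    ΣS n (interactionʷ-summand w v (s ∷ S) (t ∷ T) ∘ (true ∷_))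
interactionʷ-∷ n w v s t S T =
  trans (interactionʷ-ΣS w v (s ∷ S) (t ∷ T)) (ΣS-∷ n (interactionʷ-summand w v (s ∷ S) (t ∷ T)))

module _ (n : ℕ) (w : ℕ → ℚ) (v : SetFun₂ (suc n)) (S T : Subset n) where
  private
    I : (ℕ → ℚ) → Bool → Bool → ℚ
    I w′ b b' = interactionʷ w′ (slice v b b') S T
    summand : (ℕ → ℚ) → Bool → Bool → Subset n → ℚ
    summand w′ b b' = interactionʷ-summand w′ (slice v b b') S T
    ⊆∁ : Subset n → Bool
    ⊆∁ K = does (K ⊆? ∁ (S ∪ T))
    L : Subset n → Subset n
    L K = ∁ (K ∪ S)
    weighted : ∀ (w′ : ℕ → ℚ) K {x y} → x ≡ y → when (⊆∁ K) (w′ ∣ K ∣ * x) ≡ when (⊆∁ K) (w′ ∣ K ∣ * y)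
    weighted w′ K = cong (λ x → when (⊆∁ K) (w′ ∣ K ∣ * x))
    weighted-− : ∀ K x y → when (⊆∁ K) (w ∣ K ∣ * (x - y)) ≡ when (⊆∁ K) (w ∣ K ∣ * x) - when (⊆∁ K) (w ∣ K ∣ * y)
    weighted-− K x y = trans (cong (when (⊆∁ K)) (solve 3 (λ c x y → c :* (x :- y) := c :* x :- c :* y) refl (w ∣ K ∣) x y))
                             (when-− (⊆∁ K) _ _)
    open ≡-Reasoning

  interactionʷ-ff : interactionʷ w v (false ∷ S) (false ∷ T) ≡ I w false true + I (w ∘ suc) true false
  interactionʷ-ff = begin
    interactionʷ w v (false ∷ S) (false ∷ T)
      ≡⟨ interactionʷ-∷ n w v false false S T ⟩
    _ ≡⟨ cong₂ _+_ (sum-cong (allSubsets n) λ K → weighted w K (Δ-ff-∉ n v S T K (L K)))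
                   (sum-cong (allSubsets n) λ K → weighted (w ∘ suc) K (Δ-ff-∈ n v S T K (L K))) ⟩
    ΣS n (summand w false true) + ΣS n (summand (w ∘ suc) true false)
      ≡⟨ sym (cong₂ _+_ (interactionʷ-ΣS w (slice v false true) S T) (interactionʷ-ΣS (w ∘ suc) (slice v true false) S T)) ⟩
    I w false true + I (w ∘ suc) true false ∎

  interactionʷ-tf : interactionʷ w v (true ∷ S) (false ∷ T) ≡ I w true false - I w false false
  interactionʷ-tf = begin
    interactionʷ w v (true ∷ S) (false ∷ T)
      ≡⟨ interactionʷ-∷ n w v true false S T ⟩
    _ ≡⟨ cong₂ _+_ (sum-cong (allSubsets n) λ K →
                     trans (weighted w K (Δ-tf n v S T K (L K)))
                           (weighted-− K (Δ S T (slice v true false) K (L K)) (Δ S T (slice v false false) K (L K))))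
                   (sum-zero (allSubsets n)) ⟩
    ΣS n (λ K → summand w true false K - summand w false false K) + 0ℚ
      ≡⟨ trans (ℚₚ.+-identityʳ _) (sum-− (allSubsets n) (summand w true false) (summand w false false)) ⟩
    ΣS n (summand w true false) - ΣS n (summand w false false)
      ≡⟨ sym (cong₂ _-_ (interactionʷ-ΣS w (slice v true false) S T) (interactionʷ-ΣS w (slice v false false) S T)) ⟩
    I w true false - I w false false ∎

  interactionʷ-ft : interactionʷ w v (false ∷ S) (true ∷ T) ≡ I w false false - I w false true
  interactionʷ-ft = begin
    interactionʷ w v (false ∷ S) (true ∷ T)
      ≡⟨ interactionʷ-∷ n w v false true S T ⟩
    _ ≡⟨ cong₂ _+_ (sum-cong (allSubsets n) λ K →
                     trans (weighted w K (Δ-ft n v S T K (L K)))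
                           (weighted-− K (Δ S T (slice v false false) K (L K)) (Δ S T (slice v false true) K (L K))))
                   (sum-zero (allSubsets n)) ⟩
    ΣS n (λ K → summand w false false K - summand w false true K) + 0ℚ
      ≡⟨ trans (ℚₚ.+-identityʳ _) (sum-− (allSubsets n) (summand w false false) (summand w false true)) ⟩
    ΣS n (summand w false false) - ΣS n (summand w false true)
      ≡⟨ sym (cong₂ _-_ (interactionʷ-ΣS w (slice v false false) S T) (interactionʷ-ΣS w (slice v false true) S T)) ⟩
    I w false false - I w false true ∎

  interactionʷ-tt : interactionʷ w v (true ∷ S) (true ∷ T) ≡ 0ℚ
  interactionʷ-tt = begin
    interactionʷ w v (true ∷ S) (true ∷ T)
      ≡⟨ interactionʷ-∷ n w v true true S T ⟩
    _ ≡⟨ cong₂ _+_ (sum-cong (allSubsets n) λ K →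
                     trans (weighted w K (Δ-tt n v S T K (L K))) (cong (when (⊆∁ K)) (ℚₚ.*-zeroʳ (w ∣ K ∣))))
                   (sum-zero (allSubsets n)) ⟩
    ΣS n (λ K → when (⊆∁ K) 0ℚ) + 0ℚ
      ≡⟨ trans (ℚₚ.+-identityʳ _) (trans (sum-cong (allSubsets n) (when-0 ∘ ⊆∁)) (sum-zero (allSubsets n))) ⟩
    0ℚ ∎

-- Interaction indices as combinations of Möbius coefficients

interactionKernel : ∀ {n} → (ℕ → ℚ) → Subset n → Subset n → Subset n → Subset n → ℚ
interactionKernel w []          []          []          []           = w 0
interactionKernel w (false ∷ S) (false ∷ T) (false ∷ B) (true ∷ B')  =
  interactionKernel w S T B B' + interactionKernel (w ∘ suc) S T B B'
interactionKernel w (false ∷ S) (false ∷ T) (false ∷ B) (false ∷ B') = interactionKernel (w ∘ suc) S T B B'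
interactionKernel w (false ∷ S) (false ∷ T) (true ∷ B)  (_ ∷ B')     = interactionKernel (w ∘ suc) S T B B'
interactionKernel w (true ∷ S)  (false ∷ T) (true ∷ B)  (_ ∷ B')     = interactionKernel w S T B B'
interactionKernel w (true ∷ S)  (false ∷ T) (false ∷ B) (_ ∷ B')     = 0ℚ
interactionKernel w (false ∷ S) (true ∷ T)  (false ∷ B) (false ∷ B') = interactionKernel w S T B B'
interactionKernel w (false ∷ S) (true ∷ T)  (false ∷ B) (true ∷ B')  = 0ℚ
interactionKernel w (false ∷ S) (true ∷ T)  (true ∷ B)  (_ ∷ B')     = 0ℚ
interactionKernel w (true ∷ S)  (true ∷ T)  (_ ∷ B)     (_ ∷ B')     = 0ℚ

interactionʷ-mobius : ∀ n w (v : SetFun₂ n) S T →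
  interactionʷ w v S T ≡ Σ² n (λ B B' → interactionKernel w S T B B' * mobius v B B')
interactionʷ-mobius zero w v [] [] = sym (ℚₚ.+-identityʳ _)
interactionʷ-mobius (suc n) w v (false ∷ S) (false ∷ T) = begin
  interactionʷ w v (false ∷ S) (false ∷ T)
    ≡⟨ interactionʷ-ff n w v S T ⟩
  interactionʷ w (slice v false true) S T + interactionʷ (w ∘ suc) (slice v true false) S T
    ≡⟨ cong₂ _+_ (interactionʷ-mobius n w _ S T) (interactionʷ-mobius n (w ∘ suc) _ S T) ⟩
  Σ² n (ω w false true) + Σ² n (ω (w ∘ suc) true false)
    ≡⟨ cong (_+ Σ² n (ω (w ∘ suc) true false))
            (sym (trans (cong (_+ Σ² n (ω w false true)) (Σ²-zeroˡ n (M false false)))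
                        (ℚₚ.+-identityˡ (Σ² n (ω w false true))))) ⟩
  (Σ² n (λ B B' → 0ℚ * M false false B B') + Σ² n (ω w false true)) + Σ² n (ω (w ∘ suc) true false)
    ≡⟨ sym (Σ²-mobius-∷ n (interactionKernel w (false ∷ S) (false ∷ T)) (λ _ _ → 0ℚ)
                        (interactionKernel w S T) (interactionKernel (w ∘ suc) S T)
                        (λ B B' → ℚₚ.+-inverseʳ (interactionKernel (w ∘ suc) S T B B'))
                        (λ B B' → solve 2 (λ x y → (x :+ y) :- y := x) refl _ _)
                        (λ B B' → refl) v) ⟩
  Σ² (suc n) (λ B B' → interactionKernel w (false ∷ S) (false ∷ T) B B' * mobius v B B') ∎
  where
  open ≡-Reasoning
  M : Bool → Bool → Subset n → Subset n → ℚ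
  M b b' = mobius (slice v b b')
  ω : (ℕ → ℚ) → Bool → Bool → Subset n → Subset n → ℚ
  ω w′ b b' B B' = interactionKernel w′ S T B B' * M b b' B B'
interactionʷ-mobius (suc n) w v (true ∷ S) (false ∷ T) = begin
  interactionʷ w v (true ∷ S) (false ∷ T)
    ≡⟨ interactionʷ-tf n w v S T ⟩
  interactionʷ w (slice v true false) S T - interactionʷ w (slice v false false) S T
    ≡⟨ cong₂ _-_ (interactionʷ-mobius n w _ S T) (interactionʷ-mobius n w _ S T) ⟩
  Σ² n (ω true false) - Σ² n (ω false false)
    ≡⟨ solve 2 (λ x y → x :- y := (:- y :+ con 0ℚ) :+ x) refl (Σ² n (ω true false)) (Σ² n (ω false false)) ⟩
  (- Σ² n (ω false false) + 0ℚ) + Σ² n (ω true false)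
    ≡⟨ sym (cong (_+ Σ² n (ω true false)) (cong₂ _+_ (Σ²-neg-*ˡ n (interactionKernel w S T) (M false false))
                                                     (Σ²-zeroˡ n (M false true)))) ⟩
  (Σ² n (λ B B' → - interactionKernel w S T B B' * M false false B B') + Σ² n (λ B B' → 0ℚ * M false true B B'))
    + Σ² n (ω true false)
    ≡⟨ sym (Σ²-mobius-∷ n (interactionKernel w (true ∷ S) (false ∷ T)) (λ B B' → - interactionKernel w S T B B')
                        (λ _ _ → 0ℚ) (interactionKernel w S T)
                        (λ B B' → ℚₚ.+-identityˡ _) (λ B B' → refl) (λ B B' → refl) v) ⟩
  Σ² (suc n) (λ B B' → interactionKernel w (true ∷ S) (false ∷ T) B B' * mobius v B B') ∎
  where
  open ≡-Reasoning
  M : Bool → Bool → Subset n → Subset n → ℚ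
  M b b' = mobius (slice v b b')
  ω : Bool → Bool → Subset n → Subset n → ℚ
  ω b b' B B' = interactionKernel w S T B B' * M b b' B B'
interactionʷ-mobius (suc n) w v (false ∷ S) (true ∷ T) = begin
  interactionʷ w v (false ∷ S) (true ∷ T)
    ≡⟨ interactionʷ-ft n w v S T ⟩
  interactionʷ w (slice v false false) S T - interactionʷ w (slice v false true) S T
    ≡⟨ cong₂ _-_ (interactionʷ-mobius n w _ S T) (interactionʷ-mobius n w _ S T) ⟩
  Σ² n (ω false false) - Σ² n (ω false true)
    ≡⟨ solve 2 (λ x y → x :- y := (x :+ :- y) :+ con 0ℚ) refl (Σ² n (ω false false)) (Σ² n (ω false true)) ⟩
  (Σ² n (ω false false) + - Σ² n (ω false true)) + 0ℚ
    ≡⟨ sym (cong₂ _+_ (cong (Σ² n (ω false false) +_) (Σ²-neg-*ˡ n (interactionKernel w S T) (M false true)))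
                      (Σ²-zeroˡ n (M true false))) ⟩
  (Σ² n (ω false false) + Σ² n (λ B B' → - interactionKernel w S T B B' * M false true B B'))
    + Σ² n (λ B B' → 0ℚ * M true false B B')
    ≡⟨ sym (Σ²-mobius-∷ n (interactionKernel w (false ∷ S) (true ∷ T)) (interactionKernel w S T)
                        (λ B B' → - interactionKernel w S T B B') (λ _ _ → 0ℚ)
                        (λ B B' → ℚₚ.+-identityʳ _) (λ B B' → ℚₚ.+-identityˡ _) (λ B B' → refl) v) ⟩
  Σ² (suc n) (λ B B' → interactionKernel w (false ∷ S) (true ∷ T) B B' * mobius v B B') ∎
  where
  open ≡-Reasoning
  M : Bool → Bool → Subset n → Subset n → ℚ
  M b b' = mobius (slice v b b')
  ω : Bool → Bool → Subset n → Subset n → ℚ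
  ω b b' B B' = interactionKernel w S T B B' * M b b' B B'
interactionʷ-mobius (suc n) w v (true ∷ S) (true ∷ T) = begin
  interactionʷ w v (true ∷ S) (true ∷ T)
    ≡⟨ interactionʷ-tt n w v S T ⟩
  0ℚ
    ≡⟨ sym (cong₂ _+_ (cong₂ _+_ (Σ²-zeroˡ n (M false false)) (Σ²-zeroˡ n (M false true))) (Σ²-zeroˡ n (M true false))) ⟩
  (Σ² n (λ B B' → 0ℚ * M false false B B') + Σ² n (λ B B' → 0ℚ * M false true B B'))
    + Σ² n (λ B B' → 0ℚ * M true false B B')
    ≡⟨ sym (Σ²-mobius-∷ n (interactionKernel w (true ∷ S) (true ∷ T)) (λ _ _ → 0ℚ) (λ _ _ → 0ℚ) (λ _ _ → 0ℚ)
                        (λ B B' → refl) (λ B B' → refl) (λ B B' → refl) v) ⟩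
  Σ² (suc n) (λ B B' → interactionKernel w (true ∷ S) (true ∷ T) B B' * mobius v B B') ∎
  where
  open ≡-Reasoning
  M : Bool → Bool → Subset n → Subset n → ℚ
  M b b' = mobius (slice v b b')

interaction-Σ² : ∀ {n} (v : SetFun₂ n) S T →
  interaction v S T ≡ Σ² n (λ B B' → interactionKernel (coeff (n ∸ ∣ S ∣ ∸ ∣ T ∣)) S T B B' * mobius v B B')
interaction-Σ² {n} v S T = interactionʷ-mobius n _ v S T

-- The kernel in closed form

fromℚᵘ-+ : ∀ p q → fromℚᵘ p + fromℚᵘ q ≡ fromℚᵘ (p ℚᵘ.+ q)
fromℚᵘ-+ p q = ℚₚ.toℚᵘ-injective (ℚᵘₚ.≃-trans (ℚₚ.toℚᵘ-homo-+ (fromℚᵘ p) (fromℚᵘ q))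
  (ℚᵘₚ.≃-trans (ℚᵘₚ.+-cong (ℚₚ.toℚᵘ-fromℚᵘ p) (ℚₚ.toℚᵘ-fromℚᵘ q)) (ℚᵘₚ.≃-sym (ℚₚ.toℚᵘ-fromℚᵘ (p ℚᵘ.+ q)))))

/-+-/ : ∀ x₁ x₂ x₃ d₁ d₂ d₃ .{{_ : ℕ.NonZero d₁}} .{{_ : ℕ.NonZero d₂}} .{{_ : ℕ.NonZero d₃}} →
  (x₁ ℕ.* d₂ ℕ.+ x₂ ℕ.* d₁) ℕ.* d₃ ≡ x₃ ℕ.* (d₁ ℕ.* d₂) → ℤ.+ x₁ / d₁ + ℤ.+ x₂ / d₂ ≡ ℤ.+ x₃ / d₃
/-+-/ x₁ x₂ x₃ d₁@(suc k₁) d₂@(suc k₂) d₃@(suc k₃) eq =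
  trans (fromℚᵘ-+ (mkℚᵘ (ℤ.+ x₁) k₁) (mkℚᵘ (ℤ.+ x₂) k₂))
        (ℚₚ.fromℚᵘ-cong {mkℚᵘ (ℤ.+ x₁) k₁ ℚᵘ.+ mkℚᵘ (ℤ.+ x₂) k₂} {mkℚᵘ (ℤ.+ x₃) k₃} (*≡* (begin
    (ℤ.+ x₁ ℤ.* ℤ.+ d₂ ℤ.+ ℤ.+ x₂ ℤ.* ℤ.+ d₁) ℤ.* ℤ.+ d₃
      ≡⟨ cong (ℤ._* ℤ.+ d₃) (cong₂ ℤ._+_ (ℤₚ.pos-* x₁ d₂) (ℤₚ.pos-* x₂ d₁)) ⟨
    (ℤ.+ (x₁ ℕ.* d₂) ℤ.+ ℤ.+ (x₂ ℕ.* d₁)) ℤ.* ℤ.+ d₃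
      ≡⟨ ℤₚ.pos-* (x₁ ℕ.* d₂ ℕ.+ x₂ ℕ.* d₁) d₃ ⟨
    ℤ.+ ((x₁ ℕ.* d₂ ℕ.+ x₂ ℕ.* d₁) ℕ.* d₃)
      ≡⟨ cong ℤ.+_ eq ⟩
    ℤ.+ (x₃ ℕ.* (d₁ ℕ.* d₂))
      ≡⟨ ℤₚ.pos-* x₃ (d₁ ℕ.* d₂) ⟩
    ℤ.+ x₃ ℤ.* ℤ.+ (d₁ ℕ.* d₂) ∎)))
  where open ≡-Reasoning

coeff-+ : ∀ m₁ k₁ m₂ k₂ m₃ k₃ →
  ((m₁ ∸ k₁) ! ℕ.* k₁ ! ℕ.* suc m₂ ! ℕ.+ (m₂ ∸ k₂) ! ℕ.* k₂ ! ℕ.* suc m₁ !) ℕ.* suc m₃ ! ≡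
    (m₃ ∸ k₃) ! ℕ.* k₃ ! ℕ.* (suc m₁ ! ℕ.* suc m₂ !) →
  coeff m₁ k₁ + coeff m₂ k₂ ≡ coeff m₃ k₃
coeff-+ m₁ k₁ m₂ k₂ m₃ k₃ =
  /-+-/ ((m₁ ∸ k₁) ! ℕ.* k₁ !) ((m₂ ∸ k₂) ! ℕ.* k₂ !) ((m₃ ∸ k₃) ! ℕ.* k₃ !) (suc m₁ !) (suc m₂ !) (suc m₃ !)
        {{suc m₁ !≢0}} {{suc m₂ !≢0}} {{suc m₃ !≢0}}

-- coeff (a + b) b = a! b! / (a + b + 1)! is the beta integral B(a + 1, b + 1), and this is
-- its recursion B(a + 1, b + 1) = B(a + 2, b + 1) + B(a + 1, b + 2).
coeff-pascal : ∀ a b → coeff (suc a ℕ.+ b) b + coeff (a ℕ.+ suc b) (suc b) ≡ coeff (a ℕ.+ b) b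
coeff-pascal a b rewrite ℕₚ.+-suc a b =
  coeff-+ (suc a ℕ.+ b) b (suc (a ℕ.+ b)) (suc b) (a ℕ.+ b) b cross-multiplied
  where
  D₁ = suc (a ℕ.+ b) !
  D₂ = suc (suc (a ℕ.+ b)) !
  cross-multiplied : ((suc a ℕ.+ b ∸ b) ! ℕ.* b ! ℕ.* D₂ ℕ.+ (a ℕ.+ b ∸ b) ! ℕ.* suc b ! ℕ.* D₂) ℕ.* D₁ ≡
                     (a ℕ.+ b ∸ b) ! ℕ.* b ! ℕ.* (D₂ ℕ.* D₂)
  cross-multiplied rewrite ℕₚ.m+n∸n≡m (suc a) b | ℕₚ.m+n∸n≡m a b = identity a b (a !) (b !) ((a ℕ.+ b) !)
    where
    identity : ∀ a b A B F →
      let D₁ = (1 ℕ.+ a ℕ.+ b) ℕ.* F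
          D₂ = (2 ℕ.+ a ℕ.+ b) ℕ.* D₁
      in ((1 ℕ.+ a) ℕ.* A ℕ.* B ℕ.* D₂ ℕ.+ A ℕ.* ((1 ℕ.+ b) ℕ.* B) ℕ.* D₂) ℕ.* D₁ ≡ A ℕ.* B ℕ.* (D₂ ℕ.* D₂)
    identity = solve-∀

binomialSum : ℕ → (ℕ → ℚ) → ℚ
binomialSum zero    f = f 0
binomialSum (suc p) f = binomialSum p f + binomialSum p (f ∘ suc)

binomialSum-cong : ∀ p {f g : ℕ → ℚ} → (∀ j → f j ≡ g j) → binomialSum p f ≡ binomialSum p g
binomialSum-cong zero    f≗g = f≗g 0
binomialSum-cong (suc p) f≗g = cong₂ _+_ (binomialSum-cong p f≗g) (binomialSum-cong p (f≗g ∘ suc))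

binomialSum-coeff : ∀ p a b → binomialSum p (λ j → coeff (p ℕ.+ a ℕ.+ b) (b ℕ.+ j)) ≡ coeff (a ℕ.+ b) b
binomialSum-coeff zero    a b = cong (coeff (a ℕ.+ b)) (ℕₚ.+-identityʳ b)
binomialSum-coeff (suc p) a b = begin
  binomialSum p (λ j → coeff (suc p ℕ.+ a ℕ.+ b) (b ℕ.+ j)) +
  binomialSum p (λ j → coeff (suc p ℕ.+ a ℕ.+ b) (b ℕ.+ suc j))
    ≡⟨ cong₂ _+_ (binomialSum-cong p λ j → cong (λ m → coeff (m ℕ.+ b) (b ℕ.+ j)) (sym (ℕₚ.+-suc p a)))
                 (binomialSum-cong p λ j → cong₂ coeff (sym (ℕₚ.+-suc (p ℕ.+ a) b)) (ℕₚ.+-suc b j)) ⟩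
  binomialSum p (λ j → coeff (p ℕ.+ suc a ℕ.+ b) (b ℕ.+ j)) +
  binomialSum p (λ j → coeff (p ℕ.+ a ℕ.+ suc b) (suc b ℕ.+ j))
    ≡⟨ cong₂ _+_ (binomialSum-coeff p (suc a) b) (binomialSum-coeff p a (suc b)) ⟩
  coeff (suc a ℕ.+ b) b + coeff (a ℕ.+ suc b) (suc b)
    ≡⟨ coeff-pascal a b ⟩
  coeff (a ℕ.+ b) b ∎
  where open ≡-Reasoning

-- For disjoint S and T, admissible S T B B' says S ⊆ B, B ∩ T = ∅ and B' ∩ (S ∪ T) = ∅;
-- freeCount S T B' counts the elements outside S ∪ T ∪ B'.
admissibleAt : Bool → Bool → Bool → Bool → Bool
admissibleAt true  true  _ _  = false
admissibleAt true  false b _  = b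
admissibleAt false true  b b' = not b ∧ not b'
admissibleAt false false _ _  = true

admissible : ∀ {n} → Subset n → Subset n → Subset n → Subset n → Bool
admissible []      []      []      []        = true
admissible (s ∷ S) (t ∷ T) (b ∷ B) (b' ∷ B') = admissibleAt s t b b' ∧ admissible S T B B'

freeCount : ∀ {n} → Subset n → Subset n → Subset n → ℕ
freeCount []          []          []           = 0
freeCount (false ∷ S) (false ∷ T) (false ∷ B') = suc (freeCount S T B')
freeCount (_ ∷ S)     (_ ∷ T)     (_ ∷ B')     = freeCount S T B'

-- On overlapping pairs the kernel is meaningless, but there the Möbius transform vanishes.
interactionKernel-closed : ∀ n w (S T B B' : Subset n) → disjointᵇ B B' ≡ true →
  interactionKernel w S T B B' ≡ when (admissible S T B B') (binomialSum ∣ B' ∣ (λ j → w (freeCount S T B' ℕ.+ j)))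
interactionKernel-closed zero w [] [] [] [] _ = refl
interactionKernel-closed (suc n) w (false ∷ S) (false ∷ T) (false ∷ B) (true ∷ B') d = begin
  interactionKernel w S T B B' + interactionKernel (w ∘ suc) S T B B'
    ≡⟨ cong₂ _+_ (interactionKernel-closed n w S T B B' d) (interactionKernel-closed n (w ∘ suc) S T B B' d) ⟩
  when (admissible S T B B') (binomialSum ∣ B' ∣ (λ j → w (r ℕ.+ j))) +
  when (admissible S T B B') (binomialSum ∣ B' ∣ (λ j → w (suc (r ℕ.+ j))))
    ≡⟨ when-+ (admissible S T B B') _ _ ⟩
  when (admissible S T B B') (binomialSum ∣ B' ∣ (λ j → w (r ℕ.+ j)) + binomialSum (∣ B' ∣) (λ j → w (suc (r ℕ.+ j))))
    ≡⟨ cong (λ x → when (admissible S T B B') (binomialSum ∣ B' ∣ (λ j → w (r ℕ.+ j)) + x))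
            (binomialSum-cong ∣ B' ∣ λ j → cong w (sym (ℕₚ.+-suc r j))) ⟩
  when (admissible S T B B') (binomialSum (suc ∣ B' ∣) (λ j → w (r ℕ.+ j))) ∎
  where
  open ≡-Reasoning
  r = freeCount S T B'
interactionKernel-closed (suc n) w (false ∷ S) (false ∷ T) (false ∷ B) (false ∷ B') d =
  interactionKernel-closed n (w ∘ suc) S T B B' d
interactionKernel-closed (suc n) w (false ∷ S) (false ∷ T) (true ∷ B)  (false ∷ B') d =
  interactionKernel-closed n (w ∘ suc) S T B B' d
interactionKernel-closed (suc n) w (false ∷ S) (false ∷ T) (true ∷ B)  (true ∷ B')  ()
interactionKernel-closed (suc n) w (true ∷ S)  (false ∷ T) (true ∷ B)  (false ∷ B') d =
  interactionKernel-closed n w S T B B' d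
interactionKernel-closed (suc n) w (true ∷ S)  (false ∷ T) (true ∷ B)  (true ∷ B')  ()
interactionKernel-closed (suc n) w (true ∷ S)  (false ∷ T) (false ∷ B) (_ ∷ B')     d = refl
interactionKernel-closed (suc n) w (false ∷ S) (true ∷ T)  (false ∷ B) (false ∷ B') d =
  interactionKernel-closed n w S T B B' d
interactionKernel-closed (suc n) w (false ∷ S) (true ∷ T)  (false ∷ B) (true ∷ B')  d = refl
interactionKernel-closed (suc n) w (false ∷ S) (true ∷ T)  (true ∷ B)  (_ ∷ B')     d = refl
interactionKernel-closed (suc n) w (true ∷ S)  (true ∷ T)  (_ ∷ B)     (_ ∷ B')     d = refl

admissible-size : ∀ n (S T B B' : Subset n) → disjointᵇ B B' ≡ true → admissible S T B B' ≡ true →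
  freeCount S T B' ℕ.+ (∣ B' ∣ ℕ.+ (∣ S ∣ ℕ.+ ∣ T ∣)) ≡ n
admissible-size zero [] [] [] [] _ _ = refl
admissible-size (suc n) (false ∷ S) (false ∷ T) (false ∷ B) (false ∷ B') d a = cong suc (admissible-size n S T B B' d a)
admissible-size (suc n) (false ∷ S) (false ∷ T) (true ∷ B)  (false ∷ B') d a = cong suc (admissible-size n S T B B' d a)
admissible-size (suc n) (false ∷ S) (false ∷ T) (false ∷ B) (true ∷ B')  d a =
  trans (ℕₚ.+-suc (freeCount S T B') _) (cong suc (admissible-size n S T B B' d a))
admissible-size (suc n) (false ∷ S) (false ∷ T) (true ∷ B)  (true ∷ B')  () a
admissible-size (suc n) (true ∷ S)  (false ∷ T) (true ∷ B)  (false ∷ B') d a =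
  trans (cong (freeCount S T B' ℕ.+_) (ℕₚ.+-suc ∣ B' ∣ _))
        (trans (ℕₚ.+-suc (freeCount S T B') _) (cong suc (admissible-size n S T B B' d a)))
admissible-size (suc n) (true ∷ S)  (false ∷ T) (true ∷ B)  (true ∷ B')  () a
admissible-size (suc n) (true ∷ S)  (false ∷ T) (false ∷ B) (_ ∷ B')     d ()
admissible-size (suc n) (false ∷ S) (true ∷ T)  (false ∷ B) (false ∷ B') d a =
  trans (cong (λ k → freeCount S T B' ℕ.+ (∣ B' ∣ ℕ.+ k)) (ℕₚ.+-suc ∣ S ∣ ∣ T ∣))
  (trans (cong (freeCount S T B' ℕ.+_) (ℕₚ.+-suc ∣ B' ∣ _))
  (trans (ℕₚ.+-suc (freeCount S T B') _) (cong suc (admissible-size n S T B B' d a))))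
admissible-size (suc n) (false ∷ S) (true ∷ T)  (false ∷ B) (true ∷ B')  d ()
admissible-size (suc n) (false ∷ S) (true ∷ T)  (true ∷ B)  (_ ∷ B')     d ()
admissible-size (suc n) (true ∷ S)  (true ∷ T)  (_ ∷ B)     (_ ∷ B')     d ()

admissible-tight : ∀ n (S T B B' : Subset n) → disjointᵇ B B' ≡ true → admissible S T B B' ≡ true →
  freeCount S T B' ≡ 0 → B ≡ S × B' ≡ ∁ (S ∪ T)
admissible-tight zero [] [] [] [] _ _ _ = refl , refl
admissible-tight (suc n) (false ∷ S) (false ∷ T) (false ∷ B) (true ∷ B') d a r≡0
  with admissible-tight n S T B B' d a r≡0
... | B≡S , B'≡∁ = cong (false ∷_) B≡S , cong (true ∷_) B'≡∁
admissible-tight (suc n) (false ∷ S) (false ∷ T) (false ∷ B) (false ∷ B') d a ()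
admissible-tight (suc n) (false ∷ S) (false ∷ T) (true ∷ B)  (false ∷ B') d a ()
admissible-tight (suc n) (false ∷ S) (false ∷ T) (true ∷ B)  (true ∷ B')  () a r≡0
admissible-tight (suc n) (true ∷ S)  (false ∷ T) (true ∷ B)  (false ∷ B') d a r≡0
  with admissible-tight n S T B B' d a r≡0
... | B≡S , B'≡∁ = cong (true ∷_) B≡S , cong (false ∷_) B'≡∁
admissible-tight (suc n) (true ∷ S)  (false ∷ T) (true ∷ B)  (true ∷ B')  () a r≡0
admissible-tight (suc n) (true ∷ S)  (false ∷ T) (false ∷ B) (_ ∷ B')     d () r≡0
admissible-tight (suc n) (false ∷ S) (true ∷ T)  (false ∷ B) (false ∷ B') d a r≡0
  with admissible-tight n S T B B' d a r≡0
... | B≡S , B'≡∁ = cong (false ∷_) B≡S , cong (false ∷_) B'≡∁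
admissible-tight (suc n) (false ∷ S) (true ∷ T)  (false ∷ B) (true ∷ B')  d () r≡0
admissible-tight (suc n) (false ∷ S) (true ∷ T)  (true ∷ B)  (_ ∷ B')     d () r≡0
admissible-tight (suc n) (true ∷ S)  (true ∷ T)  (_ ∷ B)     (_ ∷ B')     d () r≡0

admissible-target : ∀ n (S T : Subset n) → disjointᵇ S T ≡ true →
  admissible S T S (∁ (S ∪ T)) ≡ true × disjointᵇ S (∁ (S ∪ T)) ≡ true × freeCount S T (∁ (S ∪ T)) ≡ 0
admissible-target zero    []          []          _ = refl , refl , refl
admissible-target (suc n) (false ∷ S) (false ∷ T) d = admissible-target n S T d
admissible-target (suc n) (true ∷ S)  (false ∷ T) d = admissible-target n S T d
admissible-target (suc n) (false ∷ S) (true ∷ T)  d = admissible-target n S T d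
admissible-target (suc n) (true ∷ S)  (true ∷ T)  ()

interactionKernel-coeff : ∀ n (S T B B' : Subset n) → disjointᵇ B B' ≡ true →
  interactionKernel (coeff (n ∸ ∣ S ∣ ∸ ∣ T ∣)) S T B B' ≡
    when (admissible S T B B') (coeff (freeCount S T B') (freeCount S T B'))
interactionKernel-coeff n S T B B' disjoint =
  trans (interactionKernel-closed n (coeff (n ∸ ∣ S ∣ ∸ ∣ T ∣)) S T B B' disjoint) (evaluate (admissible S T B B') refl)
  where
  r = freeCount S T B'
  n∸s∸t≡ : admissible S T B B' ≡ true → n ∸ ∣ S ∣ ∸ ∣ T ∣ ≡ ∣ B' ∣ ℕ.+ 0 ℕ.+ r
  n∸s∸t≡ adm = begin
    n ∸ ∣ S ∣ ∸ ∣ T ∣                               ≡⟨ ℕₚ.∸-+-assoc n ∣ S ∣ ∣ T ∣ ⟩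
    n ∸ (∣ S ∣ ℕ.+ ∣ T ∣)                           ≡⟨ cong (_∸ (∣ S ∣ ℕ.+ ∣ T ∣)) (admissible-size n S T B B' disjoint adm) ⟨
    r ℕ.+ (∣ B' ∣ ℕ.+ (∣ S ∣ ℕ.+ ∣ T ∣)) ∸ (∣ S ∣ ℕ.+ ∣ T ∣) ≡⟨ cong (_∸ (∣ S ∣ ℕ.+ ∣ T ∣)) (ℕₚ.+-assoc r ∣ B' ∣ _) ⟨
    r ℕ.+ ∣ B' ∣ ℕ.+ (∣ S ∣ ℕ.+ ∣ T ∣) ∸ (∣ S ∣ ℕ.+ ∣ T ∣) ≡⟨ ℕₚ.m+n∸n≡m (r ℕ.+ ∣ B' ∣) (∣ S ∣ ℕ.+ ∣ T ∣) ⟩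
    r ℕ.+ ∣ B' ∣                                     ≡⟨ ℕₚ.+-comm r ∣ B' ∣ ⟩
    ∣ B' ∣ ℕ.+ r                                     ≡⟨ cong (ℕ._+ r) (ℕₚ.+-identityʳ ∣ B' ∣) ⟨
    ∣ B' ∣ ℕ.+ 0 ℕ.+ r                               ∎
    where open ≡-Reasoning
  evaluate : ∀ a → admissible S T B B' ≡ a →
    when a (binomialSum ∣ B' ∣ (λ j → coeff (n ∸ ∣ S ∣ ∸ ∣ T ∣) (r ℕ.+ j))) ≡ when a (coeff r r)
  evaluate false _   = refl
  evaluate true  adm = trans (binomialSum-cong ∣ B' ∣ λ j → cong (λ m → coeff m (r ℕ.+ j)) (n∸s∸t≡ adm))
                             (binomialSum-coeff ∣ B' ∣ 0 r)

admissible-slack : ∀ n (S T B B' : Subset n) → disjointᵇ B B' ≡ true → admissible S T B B' ≡ true →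
  n ∸ 2 ≤ ∣ B' ∣ → freeCount S T B' ℕ.+ (∣ S ∣ ℕ.+ ∣ T ∣) ≤ 2
admissible-slack n S T B B' disjoint adm large = ℕₚ.+-cancelʳ-≤ ∣ B' ∣ (r ℕ.+ k) 2 (begin
  r ℕ.+ k ℕ.+ ∣ B' ∣      ≡⟨ ℕₚ.+-assoc r k ∣ B' ∣ ⟩
  r ℕ.+ (k ℕ.+ ∣ B' ∣)    ≡⟨ cong (r ℕ.+_) (ℕₚ.+-comm k ∣ B' ∣) ⟩
  r ℕ.+ (∣ B' ∣ ℕ.+ k)    ≡⟨ admissible-size n S T B B' disjoint adm ⟩
  n                        ≤⟨ ℕₚ.m≤n+m∸n n 2 ⟩
  2 ℕ.+ (n ∸ 2)            ≤⟨ ℕₚ.+-monoʳ-≤ 2 large ⟩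
  2 ℕ.+ ∣ B' ∣             ∎)
  where
  open ℕₚ.≤-Reasoning
  r = freeCount S T B'
  k = ∣ S ∣ ℕ.+ ∣ T ∣

-- 2-additive bi-capacities

module _ {n} (v : SetFun₂ n) (2-additive : Is2Additive v) where

  Σ²-mobius-point : ∀ (c : Subset n → Subset n → ℚ) B₀ B₀' →
    (∀ B B' → disjointᵇ B B' ≡ true → n ∸ 2 ≤ ∣ B' ∣ → (B ≡ B₀ → B' ≡ B₀' → ⊥) → c B B' ≡ 0ℚ) →
    Σ² n (λ B B' → c B B' * mobius v B B') ≡ c B₀ B₀' * mobius v B₀ B₀'
  Σ²-mobius-point c B₀ B₀' c≡0 = Σ²-point n (λ B B' → c B B' * mobius v B B') B₀ B₀' vanish
    where
    vanish : ∀ B B' → (B ≡ B₀ → B' ≡ B₀' → ⊥) → c B B' * mobius v B B' ≡ 0ℚ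
    vanish B B' off with disjointᵇ B B' in disjoint
    ... | false = trans (cong (c B B' *_) (mobius-overlap n v B B' disjoint)) (ℚₚ.*-zeroʳ (c B B'))
    ... | true with ∣ B' ∣ ℕ.<? n ∸ 2
    ...   | yes small = trans (cong (c B B' *_) (2-additive B B' (disjointᵇ⇒∩≡∅ B B' disjoint) small))
                              (ℚₚ.*-zeroʳ (c B B'))
    ...   | no  large = trans (cong (_* mobius v B B') (c≡0 B B' disjoint (ℕₚ.≮⇒≥ large) off))
                              (ℚₚ.*-zeroˡ (mobius v B B'))

module _ {n} (S T : Subset n) (s+t≡2 : ∣ S ∣ ℕ.+ ∣ T ∣ ≡ 2) (B B' : Subset n)
         (disjoint : disjointᵇ B B' ≡ true) (large : n ∸ 2 ≤ ∣ B' ∣) where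

  freeCount-pair : admissible S T B B' ≡ true → freeCount S T B' ≡ 0
  freeCount-pair adm = ℕₚ.n≤0⇒n≡0 (ℕₚ.+-cancelʳ-≤ 2 (freeCount S T B') 0
    (subst (λ k → freeCount S T B' ℕ.+ k ≤ 2) s+t≡2 (admissible-slack n S T B B' disjoint adm large)))

  interactionKernel-pair :
    interactionKernel (coeff (n ∸ ∣ S ∣ ∸ ∣ T ∣)) S T B B' ≡ when (admissible S T B B') 1ℚ
  interactionKernel-pair = trans (interactionKernel-coeff n S T B B' disjoint) (evaluate (admissible S T B B') refl)
    where
    r = freeCount S T B'
    evaluate : ∀ a → admissible S T B B' ≡ a → when a (coeff r r) ≡ when a 1ℚ
    evaluate false _   = refl
    evaluate true  adm = cong (λ r → coeff r r) (freeCount-pair adm)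

module _ {n} (v : SetFun₂ n) (2-additive : Is2Additive v) where

  interaction-pair : ∀ S T → disjointᵇ S T ≡ true → ∣ S ∣ ℕ.+ ∣ T ∣ ≡ 2 →
    interaction v S T ≡ mobius v S (∁ (S ∪ T))
  interaction-pair S T S∩T≡∅ s+t≡2 = begin
    interaction v S T
      ≡⟨ interaction-Σ² v S T ⟩
    Σ² n (λ B B' → ω B B' * mobius v B B')
      ≡⟨ Σ²-mobius-point v 2-additive ω S (∁ (S ∪ T)) off-target ⟩
    ω S (∁ (S ∪ T)) * mobius v S (∁ (S ∪ T))
      ≡⟨ cong (_* mobius v S (∁ (S ∪ T))) on-target ⟩
    1ℚ * mobius v S (∁ (S ∪ T))
      ≡⟨ ℚₚ.*-identityˡ (mobius v S (∁ (S ∪ T))) ⟩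
    mobius v S (∁ (S ∪ T)) ∎
    where
    open ≡-Reasoning
    ω = interactionKernel (coeff (n ∸ ∣ S ∣ ∸ ∣ T ∣)) S T
    on-target : ω S (∁ (S ∪ T)) ≡ 1ℚ
    on-target with admissible-target n S T S∩T≡∅
    ... | adm , disjoint , r≡0 = trans (interactionKernel-coeff n S T S (∁ (S ∪ T)) disjoint)
      (trans (cong (λ a → when a (coeff (freeCount S T (∁ (S ∪ T))) (freeCount S T (∁ (S ∪ T))))) adm)
             (cong (λ r → coeff r r) r≡0))
    off-target : ∀ B B' → disjointᵇ B B' ≡ true → n ∸ 2 ≤ ∣ B' ∣ → (B ≡ S → B' ≡ ∁ (S ∪ T) → ⊥) → ω B B' ≡ 0ℚ
    off-target B B' disjoint large off =
      trans (interactionKernel-pair S T s+t≡2 B B' disjoint large) (vanish (admissible S T B B') refl)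
      where
      vanish : ∀ a → admissible S T B B' ≡ a → when a 1ℚ ≡ 0ℚ
      vanish false _ = refl
      vanish true  adm with admissible-tight n S T B B' disjoint adm (freeCount-pair S T s+t≡2 B B' disjoint large adm)
      ... | B≡S , B'≡∁ = ⊥-elim (off B≡S B'≡∁)

module _ {n} (v : SetFun₂ n) (2-additive : Is2Additive v) (i : Fin n) (S T : Subset n)
         (S∩T≡∅ : disjointᵇ S T ≡ true) (s+t≡1 : ∣ S ∣ ℕ.+ ∣ T ∣ ≡ 1)
         (P : Fin n → Subset n → Subset n → ℚ)
         (P≡ : ∀ B B' → disjointᵇ B B' ≡ true → n ∸ 2 ≤ ∣ B' ∣ → ∀ j → j ≢ i →
                 P j B B' ≡ when (admissible S T B B' ∧ not (lookup B' j)) 1ℚ)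
         (i∉B' : ∀ B B' → disjointᵇ B B' ≡ true → admissible S T B B' ≡ true → lookup B' i ≡ false) where

  private
    ω : Subset n → Subset n → ℚ
    ω = interactionKernel (coeff (n ∸ ∣ S ∣ ∸ ∣ T ∣)) S T

    corrected : Subset n → Subset n → ℚ
    corrected B B' = ω B B' - ½ * sumNeq i (λ j → P j B B')

    module _ (B B' : Subset n) (disjoint : disjointᵇ B B' ≡ true) (large : n ∸ 2 ≤ ∣ B' ∣) where

      sumNeq-P : sumNeq i (λ j → P j B B') ≡ sumNeq i (λ j → when (admissible S T B B' ∧ not (lookup B' j)) 1ℚ)
      sumNeq-P = sum-filter-cong (λ j → ¬? (j ≟ i)) (allFin n) (P≡ B B' disjoint large)

      corrected-supported : corrected B B' ≡
        when (admissible S T B B') (coeff (freeCount S T B') (freeCount S T B') - ½ * fromℕ (freeCount S T B'))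
      corrected-supported = trans (cong₂ (λ x y → x - ½ * y) (interactionKernel-coeff n S T B B' disjoint) sumNeq-P)
                                  (evaluate (admissible S T B B') refl)
        where
        r = freeCount S T B'
        evaluate : ∀ a → admissible S T B B' ≡ a →
          when a (coeff r r) - ½ * sumNeq i (λ j → when (a ∧ not (lookup B' j)) 1ℚ) ≡ when a (coeff r r - ½ * fromℕ r)
        evaluate false _   = cong (λ y → 0ℚ - ½ * y) (sum-zero (filter (λ j → ¬? (j ≟ i)) (allFin n)))
        evaluate true  adm = cong (λ y → coeff r r - ½ * y) (sumNeq-count-∉ n i B' r (i∉B' B B' disjoint adm)
          (trans (cong (λ k → r ℕ.+ (∣ B' ∣ ℕ.+ k)) (sym s+t≡1)) (admissible-size n S T B B' disjoint adm)))

  Σ²-corrected-mobius : Σ² n (λ B B' → corrected B B' * mobius v B B') ≡ mobius v S (∁ (S ∪ T))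
  Σ²-corrected-mobius with admissible-target n S T S∩T≡∅
  ... | adm , disjoint , r≡0 = begin
    Σ² n (λ B B' → corrected B B' * mobius v B B')
      ≡⟨ Σ²-mobius-point v 2-additive corrected S (∁ (S ∪ T)) off-target ⟩
    corrected S (∁ (S ∪ T)) * mobius v S (∁ (S ∪ T))
      ≡⟨ cong (_* mobius v S (∁ (S ∪ T))) on-target ⟩
    1ℚ * mobius v S (∁ (S ∪ T))
      ≡⟨ ℚₚ.*-identityˡ _ ⟩
    mobius v S (∁ (S ∪ T)) ∎
    where
    open ≡-Reasoning
    large : n ∸ 2 ≤ ∣ ∁ (S ∪ T) ∣
    large = subst (n ∸ 2 ≤_) n∸1≡ (ℕₚ.∸-monoʳ-≤ n (ℕ.s≤s ℕ.z≤n))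
      where
      size : ∣ ∁ (S ∪ T) ∣ ℕ.+ 1 ≡ n
      size = trans (cong (∣ ∁ (S ∪ T) ∣ ℕ.+_) (sym s+t≡1))
             (trans (cong (ℕ._+ (∣ ∁ (S ∪ T) ∣ ℕ.+ (∣ S ∣ ℕ.+ ∣ T ∣))) (sym r≡0))
                    (admissible-size n S T S (∁ (S ∪ T)) disjoint adm))
      n∸1≡ : n ∸ 1 ≡ ∣ ∁ (S ∪ T) ∣
      n∸1≡ = trans (cong (_∸ 1) (sym size)) (ℕₚ.m+n∸n≡m ∣ ∁ (S ∪ T) ∣ 1)
    on-target : corrected S (∁ (S ∪ T)) ≡ 1ℚ
    on-target = trans (corrected-supported S (∁ (S ∪ T)) disjoint large)
                      (trans (cong (λ a → when a (coeff r r - ½ * fromℕ r)) adm) (cong (λ r → coeff r r - ½ * fromℕ r) r≡0))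
      where r = freeCount S T (∁ (S ∪ T))
    off-target : ∀ B B' → disjointᵇ B B' ≡ true → n ∸ 2 ≤ ∣ B' ∣ → (B ≡ S → B' ≡ ∁ (S ∪ T) → ⊥) →
                 corrected B B' ≡ 0ℚ
    off-target B B' disjoint large off =
      trans (corrected-supported B B' disjoint large) (vanish (admissible S T B B') refl)
      where
      r = freeCount S T B'
      vanish : ∀ a → admissible S T B B' ≡ a → when a (coeff r r - ½ * fromℕ r) ≡ 0ℚ
      vanish false _   = refl
      vanish true  adm = vanish′ r refl
        (ℕₚ.+-cancelʳ-≤ 1 r 1 (subst (λ k → r ℕ.+ k ≤ 2) s+t≡1 (admissible-slack n S T B B' disjoint adm large)))
        where
        vanish′ : ∀ r′ → r ≡ r′ → r′ ≤ 1 → coeff r′ r′ - ½ * fromℕ r′ ≡ 0ℚ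
        vanish′ zero          r≡0 _ with admissible-tight n S T B B' disjoint adm r≡0
        ... | B≡S , B'≡∁ = ⊥-elim (off B≡S B'≡∁)
        vanish′ (suc zero)    _   _ = refl  -- the weight coeff 1 1 = ½ is cancelled by the correction
        vanish′ (suc (suc _)) _   (ℕ.s≤s ())

module _ {n} (v : SetFun₂ n) (2-additive : Is2Additive v) where

  private
    ω : Subset n → Subset n → Subset n → Subset n → ℚ
    ω S T = interactionKernel (coeff (n ∸ ∣ S ∣ ∸ ∣ T ∣)) S T

  mobius-singleton : ∀ (i : Fin n) S T → disjointᵇ S T ≡ true → ∣ S ∣ ℕ.+ ∣ T ∣ ≡ 1 →
    ∀ (S₁ T₁ S₂ T₂ : Fin n → Subset n) →
    (∀ j → j ≢ i → ∣ S₁ j ∣ ℕ.+ ∣ T₁ j ∣ ≡ 2) → (∀ j → j ≢ i → ∣ S₂ j ∣ ℕ.+ ∣ T₂ j ∣ ≡ 2) →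
    (∀ B B' → disjointᵇ B B' ≡ true → ∀ j → j ≢ i →
      when (admissible (S₁ j) (T₁ j) B B') 1ℚ + when (admissible (S₂ j) (T₂ j) B B') 1ℚ ≡
      when (admissible S T B B' ∧ not (lookup B' j)) 1ℚ) →
    (∀ B B' → disjointᵇ B B' ≡ true → admissible S T B B' ≡ true → lookup B' i ≡ false) →
    mobius v S (∁ (S ∪ T)) ≡
      interaction v S T - ½ * sumNeq i (λ j → interaction v (S₁ j) (T₁ j) + interaction v (S₂ j) (T₂ j))
  mobius-singleton i S T S∩T≡∅ s+t≡1 S₁ T₁ S₂ T₂ size₁ size₂ partition i∉B' = sym (begin
    interaction v S T - ½ * sumNeq i (λ j → interaction v (S₁ j) (T₁ j) + interaction v (S₂ j) (T₂ j))
      ≡⟨ cong₂ (λ x y → x - ½ * y) (interaction-Σ² v S T) (sum-cong others λ j → pair-Σ² j) ⟩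
    Σ² n (λ B B' → ω S T B B' * mobius v B B') - ½ * sumNeq i (λ j → Σ² n (λ B B' → P j B B' * mobius v B B'))
      ≡⟨ cong (λ y → Σ² n (λ B B' → ω S T B B' * mobius v B B') - ½ * y) (Σ²-sumNeq i P (mobius v)) ⟩
    Σ² n (λ B B' → ω S T B B' * mobius v B B') - ½ * Σ² n (λ B B' → sumNeq i (λ j → P j B B') * mobius v B B')
      ≡⟨ cong (_-_ (Σ² n (λ B B' → ω S T B B' * mobius v B B'))) (Σ²-*ˡ n ½ (λ B B' → ΣP B B' * mobius v B B')) ⟨
    Σ² n (λ B B' → ω S T B B' * mobius v B B') - Σ² n (λ B B' → ½ * (ΣP B B' * mobius v B B'))
      ≡⟨ Σ²-− n (λ B B' → ω S T B B' * mobius v B B') (λ B B' → ½ * (ΣP B B' * mobius v B B')) ⟨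
    Σ² n (λ B B' → ω S T B B' * mobius v B B' - ½ * (ΣP B B' * mobius v B B'))
      ≡⟨ Σ²-cong n (λ B B' → solve 3 (λ x y m → x :* m :- con ½ :* (y :* m) := (x :- con ½ :* y) :* m) refl
                                      (ω S T B B') (ΣP B B') (mobius v B B')) ⟩
    Σ² n (λ B B' → (ω S T B B' - ½ * sumNeq i (λ j → P j B B')) * mobius v B B')
      ≡⟨ Σ²-corrected-mobius v 2-additive i S T S∩T≡∅ s+t≡1 P P≡ i∉B' ⟩
    mobius v S (∁ (S ∪ T)) ∎)
    where
    open ≡-Reasoning
    others = filter (λ j → ¬? (j ≟ i)) (allFin n)
    P : Fin n → Subset n → Subset n → ℚ
    P j B B' = ω (S₁ j) (T₁ j) B B' + ω (S₂ j) (T₂ j) B B'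
    ΣP : Subset n → Subset n → ℚ
    ΣP B B' = sumNeq i (λ j → P j B B')
    pair-Σ² : ∀ j → interaction v (S₁ j) (T₁ j) + interaction v (S₂ j) (T₂ j) ≡ Σ² n (λ B B' → P j B B' * mobius v B B')
    pair-Σ² j = trans (cong₂ _+_ (interaction-Σ² v (S₁ j) (T₁ j)) (interaction-Σ² v (S₂ j) (T₂ j)))
      (trans (sym (Σ²-+ n (λ B B' → ω (S₁ j) (T₁ j) B B' * mobius v B B') (λ B B' → ω (S₂ j) (T₂ j) B B' * mobius v B B')))
             (Σ²-cong n λ B B' → sym (ℚₚ.*-distribʳ-+ (mobius v B B') (ω (S₁ j) (T₁ j) B B') (ω (S₂ j) (T₂ j) B B'))))
    P≡ : ∀ B B' → disjointᵇ B B' ≡ true → n ∸ 2 ≤ ∣ B' ∣ → ∀ j → j ≢ i →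
           P j B B' ≡ when (admissible S T B B' ∧ not (lookup B' j)) 1ℚ
    P≡ B B' disjoint large j j≢i =
      trans (cong₂ _+_ (interactionKernel-pair (S₁ j) (T₁ j) (size₁ j j≢i) B B' disjoint large)
                       (interactionKernel-pair (S₂ j) (T₂ j) (size₂ j j≢i) B B' disjoint large))
            (partition B B' disjoint j j≢i)

disjointᵇ-∅ʳ : ∀ {n} (X : Subset n) → disjointᵇ X ∅ ≡ true
disjointᵇ-∅ʳ []          = refl
disjointᵇ-∅ʳ (true ∷ X)  = disjointᵇ-∅ʳ X
disjointᵇ-∅ʳ (false ∷ X) = disjointᵇ-∅ʳ X

disjointᵇ-∅ˡ : ∀ {n} (X : Subset n) → disjointᵇ ∅ X ≡ true
disjointᵇ-∅ˡ []      = refl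
disjointᵇ-∅ˡ (x ∷ X) = disjointᵇ-∅ˡ X

disjointᵇ-⁅⁆ : ∀ {n} (i j : Fin n) → i ≢ j → disjointᵇ ⁅ i ⁆ ⁅ j ⁆ ≡ true
disjointᵇ-⁅⁆ zero    zero    i≢j = ⊥-elim (i≢j refl)
disjointᵇ-⁅⁆ zero    (suc j) _   = disjointᵇ-∅ˡ ⁅ j ⁆
disjointᵇ-⁅⁆ (suc i) zero    _   = disjointᵇ-∅ʳ ⁅ i ⁆
disjointᵇ-⁅⁆ (suc i) (suc j) i≢j = disjointᵇ-⁅⁆ i j (i≢j ∘ cong suc)

disjointᵇ-lookup : ∀ {n} (B B' : Subset n) j → disjointᵇ B B' ≡ true → lookup B j ≡ true → lookup B' j ≡ false
disjointᵇ-lookup (true ∷ B)  (false ∷ B') zero    _  _  = refl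
disjointᵇ-lookup (true ∷ B)  (true ∷ B')  _       () _
disjointᵇ-lookup (false ∷ B) (_ ∷ B')     zero    _  ()
disjointᵇ-lookup (true ∷ B)  (false ∷ B') (suc j) d  j∈B = disjointᵇ-lookup B B' j d j∈B
disjointᵇ-lookup (false ∷ B) (_ ∷ B')     (suc j) d  j∈B = disjointᵇ-lookup B B' j d j∈B

∣pair∣≡2 : ∀ {n} (i j : Fin n) → i ≢ j → ∣ pair i j ∣ ≡ 2
∣pair∣≡2 zero    zero    i≢j = ⊥-elim (i≢j refl)
∣pair∣≡2 zero    (suc j) _   = cong suc (trans (cong ∣_∣ (∪-identityˡ ⁅ j ⁆)) (∣⁅x⁆∣≡1 j))
∣pair∣≡2 (suc i) zero    _   = cong suc (trans (cong ∣_∣ (∪-identityʳ ⁅ i ⁆)) (∣⁅x⁆∣≡1 i))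
∣pair∣≡2 (suc i) (suc j) i≢j = ∣pair∣≡2 i j (i≢j ∘ cong suc)

admissible-∅∅ : ∀ {n} (B B' : Subset n) → admissible ∅ ∅ B B' ≡ true
admissible-∅∅ []      []        = refl
admissible-∅∅ (b ∷ B) (b' ∷ B') = admissible-∅∅ B B'

admissible-⁅⁆∅ : ∀ {n} (i : Fin n) B B' → admissible ⁅ i ⁆ ∅ B B' ≡ lookup B i
admissible-⁅⁆∅ zero    (b ∷ B) (b' ∷ B') = trans (cong (b ∧_) (admissible-∅∅ B B')) (∧-identityʳ b)
admissible-⁅⁆∅ (suc i) (b ∷ B) (b' ∷ B') = admissible-⁅⁆∅ i B B'

admissible-∅⁅⁆ : ∀ {n} (i : Fin n) B B' → admissible ∅ ⁅ i ⁆ B B' ≡ not (lookup B i) ∧ not (lookup B' i)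
admissible-∅⁅⁆ zero    (b ∷ B) (b' ∷ B') = trans (cong ((not b ∧ not b') ∧_) (admissible-∅∅ B B')) (∧-identityʳ _)
admissible-∅⁅⁆ (suc i) (b ∷ B) (b' ∷ B') = admissible-∅⁅⁆ i B B'

admissible-⁅⁆⁅⁆ : ∀ {n} (i j : Fin n) → i ≢ j → ∀ B B' →
  admissible ⁅ i ⁆ ⁅ j ⁆ B B' ≡ lookup B i ∧ (not (lookup B j) ∧ not (lookup B' j))
admissible-⁅⁆⁅⁆ zero    zero    i≢j _       _         = ⊥-elim (i≢j refl)
admissible-⁅⁆⁅⁆ zero    (suc j) _   (b ∷ B) (b' ∷ B') = cong (b ∧_) (admissible-∅⁅⁆ j B B')
admissible-⁅⁆⁅⁆ (suc i) zero    _   (b ∷ B) (b' ∷ B') =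
  trans (cong ((not b ∧ not b') ∧_) (admissible-⁅⁆∅ i B B')) (∧-comm (not b ∧ not b') (lookup B i))
admissible-⁅⁆⁅⁆ (suc i) (suc j) i≢j (b ∷ B) (b' ∷ B') = admissible-⁅⁆⁅⁆ i j (i≢j ∘ cong suc) B B'

admissible-pair∅ : ∀ {n} (i j : Fin n) → i ≢ j → ∀ B B' → admissible (pair i j) ∅ B B' ≡ lookup B i ∧ lookup B j
admissible-pair∅ zero    zero    i≢j _       _         = ⊥-elim (i≢j refl)
admissible-pair∅ zero    (suc j) _   (b ∷ B) (b' ∷ B') =
  cong (b ∧_) (trans (cong (λ X → admissible X ∅ B B') (∪-identityˡ ⁅ j ⁆)) (admissible-⁅⁆∅ j B B'))
admissible-pair∅ (suc i) zero    _   (b ∷ B) (b' ∷ B') =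
  trans (cong (b ∧_) (trans (cong (λ X → admissible X ∅ B B') (∪-identityʳ ⁅ i ⁆)) (admissible-⁅⁆∅ i B B')))
        (∧-comm b (lookup B i))
admissible-pair∅ (suc i) (suc j) i≢j (b ∷ B) (b' ∷ B') = admissible-pair∅ i j (i≢j ∘ cong suc) B B'

admissible-∅pair : ∀ {n} (i j : Fin n) → i ≢ j → ∀ B B' → admissible ∅ (pair i j) B B' ≡
  (not (lookup B i) ∧ not (lookup B' i)) ∧ (not (lookup B j) ∧ not (lookup B' j))
admissible-∅pair zero    zero    i≢j _       _         = ⊥-elim (i≢j refl)
admissible-∅pair zero    (suc j) _   (b ∷ B) (b' ∷ B') =
  cong ((not b ∧ not b') ∧_) (trans (cong (λ X → admissible ∅ X B B') (∪-identityˡ ⁅ j ⁆)) (admissible-∅⁅⁆ j B B'))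
admissible-∅pair (suc i) zero    _   (b ∷ B) (b' ∷ B') =
  trans (cong ((not b ∧ not b') ∧_) (trans (cong (λ X → admissible ∅ X B B') (∪-identityʳ ⁅ i ⁆)) (admissible-∅⁅⁆ i B B')))
        (∧-comm (not b ∧ not b') _)
admissible-∅pair (suc i) (suc j) i≢j (b ∷ B) (b' ∷ B') = admissible-∅pair i j (i≢j ∘ cong suc) B B'

indicator-split : ∀ a b b' → (b ≡ true → b' ≡ false) →
  when (a ∧ b) 1ℚ + when (a ∧ (not b ∧ not b')) 1ℚ ≡ when (a ∧ not b') 1ℚ
indicator-split false _     _     _     = refl
indicator-split true  true  true  b⇒¬b' with () ← b⇒¬b' refl
indicator-split true  true  false _     = refl
indicator-split true  false true  _     = refl
indicator-split true  false false _     = refl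

module _ {n} (i : Fin n) (B B' : Subset n) (disjoint : disjointᵇ B B' ≡ true) where

  partition-⁅⁆∅ : ∀ j → j ≢ i →
    when (admissible ⁅ i ⁆ ⁅ j ⁆ B B') 1ℚ + when (admissible (pair i j) ∅ B B') 1ℚ ≡
    when (admissible ⁅ i ⁆ ∅ B B' ∧ not (lookup B' j)) 1ℚ
  partition-⁅⁆∅ j j≢i = begin
    when (admissible ⁅ i ⁆ ⁅ j ⁆ B B') 1ℚ + when (admissible (pair i j) ∅ B B') 1ℚ
      ≡⟨ cong₂ (λ x y → when x 1ℚ + when y 1ℚ) (admissible-⁅⁆⁅⁆ i j (j≢i ∘ sym) B B')
                                                (admissible-pair∅ i j (j≢i ∘ sym) B B') ⟩
    when (bᵢ ∧ (not bⱼ ∧ not b'ⱼ)) 1ℚ + when (bᵢ ∧ bⱼ) 1ℚ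
      ≡⟨ ℚₚ.+-comm (when (bᵢ ∧ (not bⱼ ∧ not b'ⱼ)) 1ℚ) (when (bᵢ ∧ bⱼ) 1ℚ) ⟩
    when (bᵢ ∧ bⱼ) 1ℚ + when (bᵢ ∧ (not bⱼ ∧ not b'ⱼ)) 1ℚ
      ≡⟨ indicator-split bᵢ bⱼ b'ⱼ (disjointᵇ-lookup B B' j disjoint) ⟩
    when (bᵢ ∧ not b'ⱼ) 1ℚ
      ≡⟨ cong (λ a → when (a ∧ not b'ⱼ) 1ℚ) (admissible-⁅⁆∅ i B B') ⟨
    when (admissible ⁅ i ⁆ ∅ B B' ∧ not b'ⱼ) 1ℚ ∎
    where
    open ≡-Reasoning
    bᵢ = lookup B i
    bⱼ = lookup B j
    b'ⱼ = lookup B' j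

  partition-∅⁅⁆ : ∀ j → j ≢ i →
    when (admissible ⁅ j ⁆ ⁅ i ⁆ B B') 1ℚ + when (admissible ∅ (pair i j) B B') 1ℚ ≡
    when (admissible ∅ ⁅ i ⁆ B B' ∧ not (lookup B' j)) 1ℚ
  partition-∅⁅⁆ j j≢i = begin
    when (admissible ⁅ j ⁆ ⁅ i ⁆ B B') 1ℚ + when (admissible ∅ (pair i j) B B') 1ℚ
      ≡⟨ cong₂ (λ x y → when x 1ℚ + when y 1ℚ) (trans (admissible-⁅⁆⁅⁆ j i j≢i B B') (∧-comm bⱼ i∉))
                                                (admissible-∅pair i j (j≢i ∘ sym) B B') ⟩
    when (i∉ ∧ bⱼ) 1ℚ + when (i∉ ∧ (not bⱼ ∧ not b'ⱼ)) 1ℚ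
      ≡⟨ indicator-split i∉ bⱼ b'ⱼ (disjointᵇ-lookup B B' j disjoint) ⟩
    when (i∉ ∧ not b'ⱼ) 1ℚ
      ≡⟨ cong (λ a → when (a ∧ not b'ⱼ) 1ℚ) (admissible-∅⁅⁆ i B B') ⟨
    when (admissible ∅ ⁅ i ⁆ B B' ∧ not b'ⱼ) 1ℚ ∎
    where
    open ≡-Reasoning
    i∉ = not (lookup B i) ∧ not (lookup B' i)
    bⱼ = lookup B j
    b'ⱼ = lookup B' j

  ∉-⁅⁆∅ : admissible ⁅ i ⁆ ∅ B B' ≡ true → lookup B' i ≡ false
  ∉-⁅⁆∅ adm = disjointᵇ-lookup B B' i disjoint (trans (sym (admissible-⁅⁆∅ i B B')) adm)

  ∉-∅⁅⁆ : admissible ∅ ⁅ i ⁆ B B' ≡ true → lookup B' i ≡ false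
  ∉-∅⁅⁆ adm = ∉ (lookup B i) (lookup B' i) (trans (sym (admissible-∅⁅⁆ i B B')) adm)
    where
    ∉ : ∀ b b' → not b ∧ not b' ≡ true → b' ≡ false
    ∉ false false _ = refl

module _ {n} (v : SetFun₂ n) (2-additive : Is2Additive v) where

  mobius-pair∅ : ∀ (i j : Fin n) → i ≢ j → mobius v (pair i j) (∁ (pair i j)) ≡ interaction v (pair i j) ∅
  mobius-pair∅ i j i≢j = trans (cong (mobius v (pair i j) ∘ ∁) (sym (∪-identityʳ (pair i j))))
    (sym (interaction-pair v 2-additive (pair i j) ∅ (disjointᵇ-∅ʳ (pair i j))
                           (cong₂ ℕ._+_ (∣pair∣≡2 i j i≢j) (∣⊥∣≡0 n))))

  mobius-∅pair : ∀ (i j : Fin n) → i ≢ j → mobius v ∅ (∁ (pair i j)) ≡ interaction v ∅ (pair i j)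
  mobius-∅pair i j i≢j = trans (cong (mobius v ∅ ∘ ∁) (sym (∪-identityˡ (pair i j))))
    (sym (interaction-pair v 2-additive ∅ (pair i j) (disjointᵇ-∅ˡ (pair i j))
                           (cong₂ ℕ._+_ (∣⊥∣≡0 n) (∣pair∣≡2 i j i≢j))))

  mobius-⁅⁆⁅⁆ : ∀ (i j : Fin n) → i ≢ j → mobius v ⁅ i ⁆ (∁ (pair i j)) ≡ interaction v ⁅ i ⁆ ⁅ j ⁆
  mobius-⁅⁆⁅⁆ i j i≢j = sym (interaction-pair v 2-additive ⁅ i ⁆ ⁅ j ⁆ (disjointᵇ-⁅⁆ i j i≢j)
                                              (cong₂ ℕ._+_ (∣⁅x⁆∣≡1 i) (∣⁅x⁆∣≡1 j)))

  mobius-⁅⁆∅ : ∀ (i : Fin n) → mobius v ⁅ i ⁆ (∁ ⁅ i ⁆) ≡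
    interaction v ⁅ i ⁆ ∅ - ½ * sumNeq i (λ j → interaction v ⁅ i ⁆ ⁅ j ⁆ + interaction v (pair i j) ∅)
  mobius-⁅⁆∅ i = trans (cong (mobius v ⁅ i ⁆ ∘ ∁) (sym (∪-identityʳ ⁅ i ⁆)))
    (mobius-singleton v 2-additive i ⁅ i ⁆ ∅ (disjointᵇ-∅ʳ ⁅ i ⁆) (cong₂ ℕ._+_ (∣⁅x⁆∣≡1 i) (∣⊥∣≡0 n))
      (λ _ → ⁅ i ⁆) ⁅_⁆ (pair i) (λ _ → ∅)
      (λ j _ → cong₂ ℕ._+_ (∣⁅x⁆∣≡1 i) (∣⁅x⁆∣≡1 j))
      (λ j j≢i → cong₂ ℕ._+_ (∣pair∣≡2 i j (j≢i ∘ sym)) (∣⊥∣≡0 n))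
      (λ B B' disjoint → partition-⁅⁆∅ i B B' disjoint) (λ B B' disjoint → ∉-⁅⁆∅ i B B' disjoint))

  mobius-∅⁅⁆ : ∀ (i : Fin n) → mobius v ∅ (∁ ⁅ i ⁆) ≡
    interaction v ∅ ⁅ i ⁆ - ½ * sumNeq i (λ j → interaction v ⁅ j ⁆ ⁅ i ⁆ + interaction v ∅ (pair i j))
  mobius-∅⁅⁆ i = trans (cong (mobius v ∅ ∘ ∁) (sym (∪-identityˡ ⁅ i ⁆)))
    (mobius-singleton v 2-additive i ∅ ⁅ i ⁆ (disjointᵇ-∅ˡ ⁅ i ⁆) (cong₂ ℕ._+_ (∣⊥∣≡0 n) (∣⁅x⁆∣≡1 i))
      ⁅_⁆ (λ _ → ⁅ i ⁆) (λ _ → ∅) (pair i)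
      (λ j _ → cong₂ ℕ._+_ (∣⁅x⁆∣≡1 j) (∣⁅x⁆∣≡1 i))
      (λ j j≢i → cong₂ ℕ._+_ (∣⊥∣≡0 n) (∣pair∣≡2 i j (j≢i ∘ sym)))
      (λ B B' disjoint → partition-∅⁅⁆ i B B' disjoint) (λ B B' disjoint → ∉-∅⁅⁆ i B B' disjoint))

proposition4 : ∀ (n : ℕ) (v : SetFun₂ n) → IsBiCapacity v → Is2Additive v →
    (∀ (i j : Fin n) → i ≢ j →
      (mobius v (pair i j) (∁ (pair i j)) ≡ interaction v (pair i j) ∅) ×
      (mobius v ∅ (∁ (pair i j)) ≡ interaction v ∅ (pair i j)) ×
      (mobius v ⁅ i ⁆ (∁ (pair i j)) ≡ interaction v ⁅ i ⁆ ⁅ j ⁆)) ×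
    (∀ (i : Fin n) →
      (mobius v ⁅ i ⁆ (∁ ⁅ i ⁆) ≡ interaction v ⁅ i ⁆ ∅ - ½ * sumNeq i (λ j → interaction v ⁅ i ⁆ ⁅ j ⁆ + interaction v (pair i j) ∅)) ×
      (mobius v ∅ (∁ ⁅ i ⁆) ≡ interaction v ∅ ⁅ i ⁆ - ½ * sumNeq i (λ j → interaction v ⁅ j ⁆ ⁅ i ⁆ + interaction v ∅ (pair i j))))
proposition4 n v _ 2-additive =
  (λ i j i≢j → mobius-pair∅ v 2-additive i j i≢j , mobius-∅pair v 2-additive i j i≢j , mobius-⁅⁆⁅⁆ v 2-additive i j i≢j) ,
  (λ i → mobius-⁅⁆∅ v 2-additive i , mobius-∅⁅⁆ v 2-additive i)
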